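{- Let $G$ be a partial cube and $u\in V(G)$. Then $G$ is a simplex graph with $u=\emptyset$ (i.e. there is a graph $H$ and an isomorphism from $G$ to the simplex graph $S(H)$ mapping $u$ to the empty clique) if and only if $W_{G,u}(x)=Cl_{G^{\#}}(x)$.
   Context: A partial cube is a graph isomorphic to an isometric subgraph of a hypercube. $W_{G,u}(x)=\sum_{d\ge0}w_dx^d$, where $w_d$ is the number of vertices of $G$ at distance $d$ from $u$. Djoković–Winkler relation $\Theta$ on $E(G)$: for edges $e=ab$, $f=xy$, $e\,\Theta\,f$ iff $d(a,x)+d(b,y)\ne d(a,y)+d(b,x)$; in a partial cube it is an equivalence relation whose classes are called $\Theta$-classes. For an edge $ab$, let $F_{ab}$ be its $\Theta$-class and $W_{ab}=\{w\in V(G): d(a,w)<d(b,w)\}$. Two $\Theta$-classes $F_{ab},F_{uv}$ cross if $W_{ab}\cap W_{uv}$, $W_{ba}\cap W_{uv}$, $W_{ab}\cap W_{vu}$, $W_{ba}\cap W_{vu}$ are all nonempty. The crossing graph $G^{\#}$ has the $\Theta$-classes of $G$ as vertices, two adjacent iff they cross. The clique polynomial of a graph $H$ is $Cl_H(x)=\sum_{i\ge0}a_ix^i$, where $a_0=1$ and $a_i$ ($i\ge1$) is the number of $i$-vertex cliques of $H$. The simplex graph $S(H)$ of a graph $H$ has as vertices all cliques of $H$ (including the empty set), two being adjacent iff they differ in exactly one vertex. -}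

module Defs where

open import Data.Nat using (ℕ; zero; suc; _+_; _≡ᵇ_; _<ᵇ_)
open import Data.Bool using (Bool; true; false; _∧_; _∨_; not; _xor_; if_then_else_)
open import Data.Fin using (Fin; zero; suc; toℕ; _≟_)
open import Data.Fin.Subset using (Subset; ⊥)
open import Data.Vec using (Vec; []; _∷_; lookup)
open import Data.List using (List; []; _∷_; length; filterᵇ; map; _++_; concatMap; allFin)
import Data.List as L
open import Data.Product using (Σ; _×_; _,_; ∃-syntax)
open import Relation.Nullary.Decidable using (⌊_⌋)
open import Relation.Binary.PropositionalEquality using (_≡_)

record Graph : Set where
  field
    n   : ℕ
    adj : Fin n → Fin n → Bool

IsSimple : Graph → Set
IsSimple G = (∀ a b → adj a b ≡ adj b a) × (∀ a → adj a a ≡ false)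
  where open Graph G

anyF : ∀ {k} → (Fin k → Bool) → Bool
anyF {zero}  p = false
anyF {suc k} p = p zero ∨ anyF (λ i → p (suc i))

allF : ∀ {k} → (Fin k → Bool) → Bool
allF {zero}  p = true
allF {suc k} p = p zero ∧ allF (λ i → p (suc i))

countF : ∀ {k} → (Fin k → Bool) → ℕ
countF {zero}  p = 0
countF {suc k} p = (if p zero then 1 else 0) + countF (λ i → p (suc i))

eqF : ∀ {k} → Fin k → Fin k → Bool
eqF i j = ⌊ i ≟ j ⌋

module _ (G : Graph) where
  open Graph G

  reach : ℕ → Fin n → Fin n → Bool
  reach zero    a b = eqF a b
  reach (suc k) a b = reach k a b ∨ anyF (λ c → reach k a c ∧ adj c b)

  Connected : Set
  Connected = ∀ a b → ∃[ k ] reach k a b ≡ true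

  -- shortest-path distance: number of k < n with no walk of length ≤ k
  -- (for a connected graph this is the least k with reach k a b)
  dist : Fin n → Fin n → ℕ
  dist a b = countF {n} (λ k → not (reach (toℕ k) a b))

  -- G is isomorphic to an isometric subgraph of the hypercube Q_m
  -- (equivalently: G is connected and isometrically embeds into some Q_m)
  IsPartialCube : Set
  IsPartialCube =
    Connected ×
    Σ ℕ λ m → Σ (Fin n → Fin m → Bool) λ f →
      ∀ a b → countF (λ i → f a i xor f b i) ≡ dist a b

  Wb : Fin n → Fin n → Fin n → Bool
  Wb a b w = dist a w <ᵇ dist b w

  Θb : Fin n → Fin n → Fin n → Fin n → Bool
  Θb a b x y = not ((dist a x + dist b y) ≡ᵇ (dist a y + dist b x))

  crossB : Fin n → Fin n → Fin n → Fin n → Bool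
  crossB a b x y =
    anyF (λ w → Wb a b w ∧ Wb x y w) ∧ anyF (λ w → Wb b a w ∧ Wb x y w) ∧
    anyF (λ w → Wb a b w ∧ Wb y x w) ∧ anyF (λ w → Wb b a w ∧ Wb y x w)

  lexLt : Fin n → Fin n → Fin n → Fin n → Bool
  lexLt x y a b = (toℕ x <ᵇ toℕ a) ∨ (eqF x a ∧ (toℕ y <ᵇ toℕ b))

  canonical : Fin n → Fin n → Bool
  canonical a b = adj a b ∧ (toℕ a <ᵇ toℕ b) ∧
    not (anyF (λ x → anyF (λ y →
      adj x y ∧ (toℕ x <ᵇ toℕ y) ∧ Θb a b x y ∧ lexLt x y a b)))

  allPairs : List (Fin n × Fin n)
  allPairs = concatMap (λ a → map (λ b → (a , b)) (allFin n)) (allFin n)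

  classReps : List (Fin n × Fin n)
  classReps = filterᵇ (λ p → canonical (Data.Product.proj₁ p) (Data.Product.proj₂ p)) allPairs

  -- the crossing graph G#: vertices = Θ-classes (via representatives)
  crossingGraph : Graph
  crossingGraph = record
    { n   = length classReps
    ; adj = λ i j → crossB (Data.Product.proj₁ (L.lookup classReps i))
                           (Data.Product.proj₂ (L.lookup classReps i))
                           (Data.Product.proj₁ (L.lookup classReps j))
                           (Data.Product.proj₂ (L.lookup classReps j))
    }

  -- coefficient w_d of W_{G,u}(x)
  wCoeff : Fin n → ℕ → ℕ
  wCoeff u d = countF (λ v → dist u v ≡ᵇ d)

allSubsets : ∀ m → List (Subset m)
allSubsets zero    = [] ∷ []
allSubsets (suc m) = map (true ∷_) (allSubsets m) ++ map (false ∷_) (allSubsets m)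

module _ (H : Graph) where
  open Graph H

  isClique : Subset n → Bool
  isClique s = allF (λ i → allF (λ j →
    not (lookup s i ∧ lookup s j ∧ not (eqF i j)) ∨ adj i j))

  size : Subset n → ℕ
  size s = countF (lookup s)

  -- coefficient a_i of Cl_H(x): number of i-vertex cliques (a_0 = 1: the empty clique)
  clCoeff : ℕ → ℕ
  clCoeff i = length (filterB (allSubsets n))
    where
      filterB : List (Subset n) → List (Subset n)
      filterB = filterᵇ (λ s → isClique s ∧ (size s ≡ᵇ i))

  simplexAdj : Subset n → Subset n → Bool
  simplexAdj s t = countF (λ i → lookup s i xor lookup t i) ≡ᵇ 1

IsSimplexGraphAt : (G : Graph) → Fin (Graph.n G) → Set
IsSimplexGraphAt G u =
  Σ Graph λ H → IsSimple H ×
  Σ (Fin (Graph.n G) → Subset (Graph.n H)) λ f →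
    (∀ a b → f a ≡ f b → a ≡ b) ×
    (∀ a → isClique H (f a) ≡ true) ×
    (∀ s → isClique H s ≡ true → ∃[ a ] f a ≡ s) ×
    (∀ a b → Graph.adj G a b ≡ simplexAdj H (f a) (f b)) ×
    f u ≡ ⊥

{-# OPTIONS --safe #-}

-- Send each vertex w of the partial cube G to the set of Θ-classes separating it from u.
-- Reading a Θ-class as the cube coordinate flipped by its edges, this is an isometric embedding
-- into the hypercube over the Θ-classes; it sends u to ∅, edges to pairs of sets differing in
-- one class, and the vertices at distance d from u to d-element sets.
--
-- If every Θ-class has an edge at u, i.e. every singleton {r} is the set of some vertex, then
-- every separating set is a clique of G#: moving away from u along a shortest path adds one
-- class r₀ at a time, and r₀ crosses each class j already present, because the current vertex,
-- the neighbour of u across r₀, the previous vertex and u lie in the four sides of r₀ and j.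
-- So the vertices at distance d inject into the d-cliques of G#, and w_d = a_d says exactly
-- that this injection is onto.
--
-- (⇐) w₁ = a₁ makes the level-1 injection onto the singletons, so every Θ-class has an edge at
-- u, and then equality at every level makes the embedding a bijection onto the cliques of G#,
-- that is, an isomorphism G ≅ S(G#) sending u to ∅.
-- (⇒) An isomorphism φ : G ≅ S(H) with φ u = ∅ is itself an isometric hypercube embedding, so
-- every Θ-class flips a single vertex of H, distinct classes flipping distinct vertices, and the
-- separating set of w is φ w read through this correspondence.  Hence singletons are realised,
-- and the image of a clique of G# is a clique of H, whose preimage under φ is a vertex with
-- that clique as separating set.

module Submission where

open import Defs
open import Data.Bool using (Bool; true; false; _∧_; _∨_; not; _xor_; if_then_else_)
import Data.Bool.Properties as Bool
open import Data.Bool.Properties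
  using ( ∧-conicalˡ; ∧-conicalʳ; ∧-zeroʳ; ∨-zeroʳ; not-injective; not-involutive; ¬-not
        ; xor-same; xor-comm; T-≡)
open import Data.Empty using (⊥-elim)
open import Data.Fin using (Fin; zero; suc; toℕ; _≟_)
import Data.Fin.Properties as Fin
open import Data.Fin.Subset using (Subset; ⁅_⁆)
import Data.Fin.Subset as Subset
open import Data.Fin.Subset.Properties using (x∈⁅x⁆; x∈⁅y⁆⇒x≡y)
open import Data.List
  using (List; []; _∷_; length; filterᵇ; _++_; map; tabulate; allFin; concatMap; cartesianProduct)
import Data.List as List
open import Data.List.Membership.Propositional using (_∈_; _∉_)
open import Data.List.Membership.Propositional.Properties
  using ( ∈-∃++; ∈-filter⁺; ∈-filter⁻; ∈-map⁺; ∈-map⁻; ∈-allFin; ∈-++⁺ˡ; ∈-++⁺ʳ; ∈-lookup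
        ; ∈-cartesianProduct⁺)
open import Data.List.Properties using (length-++-sucʳ; length-map)
open import Data.List.Relation.Binary.Subset.Propositional using (_⊆_)
import Data.List.Relation.Unary.All as All
open import Data.List.Relation.Unary.AllPairs using ([]; _∷_)
open import Data.List.Relation.Unary.Any using (here; there; index)
open import Data.List.Relation.Unary.Any.Properties using (lookup-index)
open import Data.List.Relation.Unary.Unique.Propositional using (Unique)
import Data.List.Relation.Unary.Unique.Propositional.Properties as Unique
open import Data.Nat using (ℕ; zero; suc; _+_; _*_; _∸_; _≤_; _<_; z≤n; s≤s; _≡ᵇ_; _<ᵇ_; _≤?_)
open import Data.Nat.Induction using (Acc; acc; <-wellFounded)
open import Data.Nat.Properties
  using ( suc-injective; ≤-reflexive; ≤-trans; ≤-antisym; ≤-pred; <-trans; <-irrefl; <-cmp; <⇒≤; <⇒≢; <⇒≱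
        ; ≤⇒≯; ≰⇒>
        ; n≤1+n; n<1+n; m≤n⇒m≤1+n; m≤m+n; n≤0⇒n≡0; 0≢1+n; 1+n≰n; m≢1+n+m; m≢1+m+n; m∸n+n≡m
        ; +-comm; +-assoc; +-suc; +-identityʳ; +-cancelʳ-≡; +-mono-≤; +-monoʳ-≤; +-monoʳ-<; *-monoˡ-≤
        ; <⇒<ᵇ; <ᵇ⇒<; ≡⇒≡ᵇ; ≡ᵇ⇒≡; module ≤-Reasoning)
open import Data.Product using (_×_; _,_; proj₁; proj₂; ∃-syntax)
open import Data.Sum using (_⊎_; inj₁; inj₂)
open import Data.Vec using (Vec; []; _∷_; lookup; _[_]≔_)
import Data.Vec as Vec
open import Data.Vec.Properties
  using ( ∷-injectiveʳ; ≡-dec; lookup∘tabulate; tabulate-cong; tabulate∘lookup; lookup-replicate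
        ; []=⇒lookup; lookup⇒[]=; lookup∘update; lookup∘update′)
open import Function using (_∘_; id; case_of_)
open import Function.Bundles using (_⇔_; mk⇔; Equivalence)
open import Function.Definitions using (Injective)
open import Relation.Binary.Definitions using (DecidableEquality; tri<; tri≈; tri>)
open import Relation.Binary.PropositionalEquality
  using (_≡_; _≢_; refl; sym; trans; cong; cong₂; subst; subst₂; module ≡-Reasoning)
open import Relation.Nullary using (¬_; yes; no; Dec)
open import Relation.Nullary.Decidable using (T?)

true≢false : true ≢ false
true≢false ()

∧₄-elim : ∀ {a b c d} → a ∧ b ∧ c ∧ d ≡ true → a ≡ true × b ≡ true × c ≡ true × d ≡ true
∧₄-elim {true} {true} {true} {true} _ = refl , refl , refl , refl

∨-true-resolve : ∀ {x y} → x ∨ y ≡ true → x ≡ false → y ≡ true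
∨-true-resolve e refl = e

∨-trueʳ : ∀ x {y} → y ≡ true → x ∨ y ≡ true
∨-trueʳ x refl = ∨-zeroʳ x

∧-intro : ∀ {x y} → x ≡ true → y ≡ true → x ∧ y ≡ true
∧-intro refl refl = refl

≢true⇒≡false : ∀ {b} → b ≢ true → b ≡ false
≢true⇒≡false = ¬-not

≢false⇒≡true : ∀ {b} → b ≢ false → b ≡ true
≢false⇒≡true = ¬-not

bool-ext : ∀ {x y} → (x ≡ true → y ≡ true) → (y ≡ true → x ≡ true) → x ≡ y
bool-ext {true}  {true}  _ _ = refl
bool-ext {false} {false} _ _ = refl
bool-ext {true}  {false} h _ = sym (h refl)
bool-ext {false} {true}  _ h = h refl

xor-false⇒≡ : ∀ {x y} → x xor y ≡ false → x ≡ y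
xor-false⇒≡ {true}  {true}  _ = refl
xor-false⇒≡ {false} {false} _ = refl

xor-involutiveˡ : ∀ c x → c xor (c xor x) ≡ x
xor-involutiveˡ true  x = not-involutive x
xor-involutiveˡ false x = refl

xor-cancel-common : ∀ c x y → (c xor x) xor (c xor y) ≡ x xor y
xor-cancel-common true  true  y     = refl
xor-cancel-common true  false true  = refl
xor-cancel-common true  false false = refl
xor-cancel-common false x     y     = refl

xor-not-cancel : ∀ x y c → not (x xor c) xor not (y xor c) ≡ x xor y
xor-not-cancel true  true  c     = xor-same (not (not c))
xor-not-cancel false false c     = xor-same (not c)
xor-not-cancel true  false true  = refl
xor-not-cancel true  false false = refl
xor-not-cancel false true  true  = refl
xor-not-cancel false true  false = refl

matches : Bool → Bool → Bool
matches α x = if α then x else not x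

matches-true : ∀ α {x} → x ≡ α → matches α x ≡ true
matches-true true  refl = refl
matches-true false refl = refl

matches-true⁻ : ∀ α {x} → matches α x ≡ true → x ≡ α
matches-true⁻ true  e = e
matches-true⁻ false e = not-injective e

<ᵇ-true : ∀ {m n} → m < n → (m <ᵇ n) ≡ true
<ᵇ-true m<n = Equivalence.to T-≡ (<⇒<ᵇ m<n)

<ᵇ-true⁻ : ∀ {m n} → (m <ᵇ n) ≡ true → m < n
<ᵇ-true⁻ {m} {n} e = <ᵇ⇒< m n (Equivalence.from T-≡ e)

<ᵇ-false : ∀ {m n} → n ≤ m → (m <ᵇ n) ≡ false
<ᵇ-false {m} {n} n≤m = ≢true⇒≡false (λ e → ≤⇒≯ n≤m (<ᵇ-true⁻ e))

≡ᵇ-true : ∀ {m n} → m ≡ n → (m ≡ᵇ n) ≡ true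
≡ᵇ-true {m} {n} m≡n = Equivalence.to T-≡ (≡⇒≡ᵇ m n m≡n)

≡ᵇ-true⁻ : ∀ {m n} → (m ≡ᵇ n) ≡ true → m ≡ n
≡ᵇ-true⁻ {m} {n} e = ≡ᵇ⇒≡ m n (Equivalence.from T-≡ e)

≡ᵇ-false : ∀ {m n} → m ≢ n → (m ≡ᵇ n) ≡ false
≡ᵇ-false m≢n = ≢true⇒≡false (λ e → m≢n (≡ᵇ-true⁻ e))

eqF-refl : ∀ {k} (i : Fin k) → eqF i i ≡ true
eqF-refl i with i ≟ i
... | yes _  = refl
... | no i≢i = ⊥-elim (i≢i refl)

eqF-true⁻ : ∀ {k} {i j : Fin k} → eqF i j ≡ true → i ≡ j
eqF-true⁻ {i = i} {j} e with i ≟ j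
... | yes i≡j = i≡j

eqF-false : ∀ {k} {i j : Fin k} → i ≢ j → eqF i j ≡ false
eqF-false {i = i} {j} i≢j with i ≟ j
... | yes i≡j = ⊥-elim (i≢j i≡j)
... | no _    = refl

indicator : Bool → ℕ
indicator b = if b then 1 else 0

countF-cong : ∀ {k} {p q : Fin k → Bool} → (∀ i → p i ≡ q i) → countF p ≡ countF q
countF-cong {zero}  e = refl
countF-cong {suc k} e = cong₂ _+_ (cong indicator (e zero)) (countF-cong (λ i → e (suc i)))

countF-false : ∀ k → countF {k} (λ _ → false) ≡ 0
countF-false zero    = refl
countF-false (suc k) = countF-false k

countF-true : ∀ k → countF {k} (λ _ → true) ≡ k
countF-true zero    = refl
countF-true (suc k) = cong suc (countF-true k)

countF-none : ∀ {k} (p : Fin k → Bool) → (∀ i → p i ≡ false) → countF p ≡ 0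
countF-none {k} p none = trans (countF-cong none) (countF-false k)

countF-mono : ∀ {k} (p q : Fin k → Bool) → (∀ i → p i ≡ true → q i ≡ true) → countF p ≤ countF q
countF-mono {zero}  p q p⊆q = z≤n
countF-mono {suc k} p q p⊆q with p zero in p₀ | q zero in q₀
... | true  | true  = s≤s (countF-mono _ _ (λ i → p⊆q (suc i)))
... | true  | false = ⊥-elim (true≢false (trans (sym (p⊆q zero p₀)) q₀))
... | false | true  = m≤n⇒m≤1+n (countF-mono _ _ (λ i → p⊆q (suc i)))
... | false | false = countF-mono _ _ (λ i → p⊆q (suc i))

countF-mono-strict : ∀ {k} (p q : Fin k → Bool) → (∀ i → p i ≡ true → q i ≡ true) →
  ∀ i → p i ≡ false → q i ≡ true → countF p < countF q
countF-mono-strict p q p⊆q zero p₀ q₀ rewrite p₀ | q₀ = s≤s (countF-mono _ _ (λ i → p⊆q (suc i)))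
countF-mono-strict p q p⊆q (suc i) pᵢ qᵢ with p zero in p₀ | q zero in q₀
... | true  | true  = s≤s (countF-mono-strict _ _ (λ j → p⊆q (suc j)) i pᵢ qᵢ)
... | true  | false = ⊥-elim (true≢false (trans (sym (p⊆q zero p₀)) q₀))
... | false | true  = m≤n⇒m≤1+n (countF-mono-strict _ _ (λ j → p⊆q (suc j)) i pᵢ qᵢ)
... | false | false = countF-mono-strict _ _ (λ j → p⊆q (suc j)) i pᵢ qᵢ

countF-pos : ∀ {k} (p : Fin k → Bool) i → p i ≡ true → 0 < countF p
countF-pos {k} p i pᵢ =
  subst (_< countF p) (countF-false k) (countF-mono-strict (λ _ → false) p (λ _ ()) i refl pᵢ)

countF-pos⇒∃ : ∀ {k} (p : Fin k → Bool) → 0 < countF p → ∃[ i ] p i ≡ true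
countF-pos⇒∃ {suc k} p pos with p zero in p₀
... | true  = zero , p₀
... | false with countF-pos⇒∃ (λ i → p (suc i)) pos
...   | i , pᵢ = suc i , pᵢ

countF≡0⇒false : ∀ {k} (p : Fin k → Bool) → countF p ≡ 0 → ∀ i → p i ≡ false
countF≡0⇒false p p≡0 i = ≢true⇒≡false (λ pᵢ → <⇒≢ (countF-pos p i pᵢ) (sym p≡0))

countF-full : ∀ {k} (p : Fin k → Bool) → k ≤ countF p → ∀ i → p i ≡ true
countF-full {k} p full i = ≢false⇒≡true λ pᵢ → <⇒≱
  (countF-mono-strict p (λ _ → true) (λ _ _ → refl) i pᵢ refl)
  (subst (_≤ countF p) (sym (countF-true k)) full)

countF≡1⇒unique : ∀ {k} (p : Fin k → Bool) → countF p ≡ 1 →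
  ∀ i j → p i ≡ true → p j ≡ true → i ≡ j
countF≡1⇒unique p p≡1 i j pᵢ pⱼ with i ≟ j
... | yes i≡j = i≡j
... | no  i≢j = ⊥-elim (<-irrefl (sym p≡1) (≤-trans (s≤s (countF-pos p-j i p-jᵢ))
                                              (countF-mono-strict p-j p (λ x → ∧-conicalˡ _ _) j p-jⱼ pⱼ)))
  where
    p-j : _ → Bool
    p-j x = p x ∧ not (eqF x j)
    p-jᵢ : p-j i ≡ true
    p-jᵢ rewrite pᵢ | eqF-false i≢j = refl
    p-jⱼ : p-j j ≡ false
    p-jⱼ rewrite eqF-refl j = ∧-zeroʳ (p j)

countF-singleton : ∀ {k} (p : Fin k → Bool) i → p i ≡ true → (∀ j → p j ≡ true → j ≡ i) →
  countF p ≡ 1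
countF-singleton p zero p₀ only rewrite p₀ =
  cong suc (countF-none _ (λ j → ≢true⇒≡false (λ pⱼ → Fin.0≢1+n (sym (only (suc j) pⱼ)))))
countF-singleton p (suc i) pᵢ only with p zero in p₀
... | true  with only zero p₀
...   | ()
countF-singleton p (suc i) pᵢ only | false =
  countF-singleton _ i pᵢ (λ j pⱼ → Fin.suc-injective (only (suc j) pⱼ))

countF-update : ∀ {k} (p q : Fin k → Bool) i → (∀ j → j ≢ i → p j ≡ q j) →
  countF p + indicator (q i) ≡ countF q + indicator (p i)
countF-update p q zero agree
  rewrite countF-cong {p = λ j → p (suc j)} {q = λ j → q (suc j)} (λ j → agree (suc j) (λ ()))
  = swap (indicator (p zero)) _ (indicator (q zero))
  where
    swap : ∀ a r b → a + r + b ≡ b + r + a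
    swap a r b = trans (+-comm (a + r) b) (trans (cong (b +_) (+-comm a r)) (sym (+-assoc b r a)))
countF-update p q (suc i) agree rewrite agree zero (λ ()) =
  trans (+-assoc (indicator (q zero)) _ _)
    (trans (cong (indicator (q zero) +_)
                 (countF-update _ _ i (λ j j≢i → agree (suc j) (λ e → j≢i (Fin.suc-injective e)))))
           (sym (+-assoc (indicator (q zero)) _ _)))

indicator-growth : ∀ p q X → p xor q ≡ true → X + indicator q ≡ suc X + indicator p → q ≡ true × p ≡ false
indicator-growth false true  X _ _ = refl , refl
indicator-growth true  false X _ e = ⊥-elim (m≢1+m+n X (trans (sym (+-identityʳ X)) e))

countF-∨ : ∀ {k} (p q : Fin k → Bool) → countF (λ i → p i ∨ q i) ≤ countF p + countF q
countF-∨ {zero}  p q = z≤n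
countF-∨ {suc k} p q with p zero | q zero | countF-∨ (λ i → p (suc i)) (λ i → q (suc i))
... | true  | true  | ih = s≤s (≤-trans ih (+-monoʳ-≤ (countF (λ i → p (suc i))) (n≤1+n _)))
... | true  | false | ih = s≤s ih
... | false | true  | ih = ≤-trans (s≤s ih) (≤-reflexive (sym (+-suc _ _)))
... | false | false | ih = ih

countF-bounded : ∀ {k} (p : Fin k → Bool) b → (∀ i → p i ≡ true → toℕ i < b) → countF p ≤ b
countF-bounded {zero}  p b below = z≤n
countF-bounded {suc k} p b below with p zero in p₀
countF-bounded {suc k} p zero    below | true with below zero p₀
... | ()
countF-bounded {suc k} p (suc b) below | true =
  s≤s (countF-bounded _ b (λ i pᵢ → ≤-pred (below (suc i) pᵢ)))
countF-bounded {suc k} p b       below | false =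
  countF-bounded _ b (λ i pᵢ → <-trans (n<1+n _) (below (suc i) pᵢ))

countF-prefix : ∀ {k} (p : Fin k → Bool) d → d < k → (∀ i → toℕ i ≤ d → p i ≡ true) → d < countF p
countF-prefix {suc k} p d d<k prefix rewrite prefix zero z≤n with d
... | zero   = s≤s z≤n
... | suc d' = s≤s (countF-prefix _ d' (≤-pred d<k) (λ i i≤d' → prefix (suc i) (s≤s i≤d')))

anyF-intro : ∀ {k} (p : Fin k → Bool) i → p i ≡ true → anyF p ≡ true
anyF-intro p zero    p₀ rewrite p₀ = refl
anyF-intro p (suc i) pᵢ = ∨-trueʳ (p zero) (anyF-intro _ i pᵢ)

anyF-elim : ∀ {k} (p : Fin k → Bool) → anyF p ≡ true → ∃[ i ] p i ≡ true
anyF-elim {suc k} p any with p zero in p₀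
... | true  = zero , p₀
... | false with anyF-elim (λ j → p (suc j)) any
...   | i , pᵢ = suc i , pᵢ

anyF-false⁻ : ∀ {k} (p : Fin k → Bool) → anyF p ≡ false → ∀ i → p i ≡ false
anyF-false⁻ p none i = ≢true⇒≡false (λ pᵢ → true≢false (trans (sym (anyF-intro p i pᵢ)) none))

anyF-cong : ∀ {k} {p q : Fin k → Bool} → (∀ i → p i ≡ q i) → anyF p ≡ anyF q
anyF-cong {zero}  e = refl
anyF-cong {suc k} e = cong₂ _∨_ (e zero) (anyF-cong (λ i → e (suc i)))

allF-intro : ∀ {k} (p : Fin k → Bool) → (∀ i → p i ≡ true) → allF p ≡ true
allF-intro {zero}  p all = refl
allF-intro {suc k} p all rewrite all zero = allF-intro _ (λ i → all (suc i))

allF-elim : ∀ {k} (p : Fin k → Bool) → allF p ≡ true → ∀ i → p i ≡ true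
allF-elim p all zero    = ∧-conicalˡ _ _ all
allF-elim p all (suc i) = allF-elim _ (∧-conicalʳ (p zero) _ all) i

module _ {A : Set} where

  ⊆-remove : ∀ {x : A} ys {zs xs} → xs ⊆ ys ++ x ∷ zs → x ∉ xs → xs ⊆ ys ++ zs
  ⊆-remove ys xs⊆ x∉xs w∈xs = remove ys (xs⊆ w∈xs) (λ { refl → x∉xs w∈xs })
    where
      remove : ∀ {w x : A} ys {zs} → w ∈ ys ++ x ∷ zs → w ≢ x → w ∈ ys ++ zs
      remove []       (here w≡x) w≢x = ⊥-elim (w≢x w≡x)
      remove []       (there w∈) w≢x = w∈
      remove (y ∷ ys) (here w≡y) w≢x = here w≡y
      remove (y ∷ ys) (there w∈) w≢x = there (remove ys w∈ w≢x)

  Unique⊆⇒length≤ : {xs ys : List A} → Unique xs → xs ⊆ ys → length xs ≤ length ys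
  Unique⊆⇒length≤ {[]}     _            _ = z≤n
  Unique⊆⇒length≤ {x ∷ xs} (x∉xs ∷ uxs) ⊆ys with ∈-∃++ (⊆ys (here refl))
  ... | ys₁ , ys₂ , refl = subst (suc (length xs) ≤_) (sym (length-++-sucʳ ys₁ x ys₂))
    (s≤s (Unique⊆⇒length≤ uxs (⊆-remove ys₁ (⊆ys ∘ there) (λ x∈ → All.lookup x∉xs x∈ refl))))

  Unique-⊆-⊇⇒length≡ : {xs ys : List A} → Unique xs → Unique ys → xs ⊆ ys → ys ⊆ xs →
    length xs ≡ length ys
  Unique-⊆-⊇⇒length≡ uxs uys xs⊆ys ys⊆xs =
    ≤-antisym (Unique⊆⇒length≤ uxs xs⊆ys) (Unique⊆⇒length≤ uys ys⊆xs)

  Unique⊆-length≡⇒⊇ : DecidableEquality A → {xs ys : List A} → Unique xs → xs ⊆ ys →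
    length xs ≡ length ys → ys ⊆ xs
  Unique⊆-length≡⇒⊇ _≟ₐ_ {xs} uxs xs⊆ys len {y} y∈ys with y ∈? xs
    where open import Data.List.Membership.DecPropositional _≟ₐ_ using (_∈?_)
  ... | yes y∈xs = y∈xs
  ... | no  y∉xs with ∈-∃++ y∈ys
  ...   | ys₁ , ys₂ , refl = ⊥-elim (<-irrefl len
    (subst (suc (length xs) ≤_) (sym (length-++-sucʳ ys₁ y ys₂))
      (s≤s (Unique⊆⇒length≤ uxs (⊆-remove ys₁ xs⊆ys y∉xs)))))

module _ {A : Set} {p : A → Bool} where

  ∈-filterᵇ⁺ : ∀ {x xs} → x ∈ xs → p x ≡ true → x ∈ filterᵇ p xs
  ∈-filterᵇ⁺ x∈ px = ∈-filter⁺ (T? ∘ p) x∈ (Equivalence.from T-≡ px)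

  ∈-filterᵇ⁻ : ∀ {x} xs → x ∈ filterᵇ p xs → x ∈ xs × p x ≡ true
  ∈-filterᵇ⁻ xs x∈ with ∈-filter⁻ (T? ∘ p) {xs = xs} x∈
  ... | x∈xs , px = x∈xs , Equivalence.to T-≡ px

length-filterᵇ-tabulate : ∀ {A : Set} {k} (f : Fin k → A) (p : A → Bool) →
  length (filterᵇ p (tabulate f)) ≡ countF (p ∘ f)
length-filterᵇ-tabulate {k = zero}  f p = refl
length-filterᵇ-tabulate {k = suc k} f p with p (f zero)
... | true  = cong suc (length-filterᵇ-tabulate (f ∘ suc) p)
... | false = length-filterᵇ-tabulate (f ∘ suc) p

countF-reindex : ∀ {k l} (c : Fin k → Fin l) → Injective _≡_ _≡_ c → (q : Fin l → Bool) →
  (∀ i → q i ≡ true → ∃[ r ] c r ≡ i) → countF (q ∘ c) ≡ countF q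
countF-reindex {k} {l} c c-inj q q⊆image = begin
  countF (q ∘ c)                               ≡⟨ length-filterᵇ-tabulate id (q ∘ c) ⟨
  length (filterᵇ (q ∘ c) (allFin k))          ≡⟨ length-map c (filterᵇ (q ∘ c) (allFin k)) ⟨
  length (map c (filterᵇ (q ∘ c) (allFin k)))  ≡⟨ Unique-⊆-⊇⇒length≡ unique-image unique-q into onto ⟩
  length (filterᵇ q (allFin l))                ≡⟨ length-filterᵇ-tabulate id q ⟩
  countF q                                     ∎
  where
    open ≡-Reasoning
    unique-image = Unique.map⁺ c-inj (Unique.filter⁺ _ (Unique.allFin⁺ k))
    unique-q = Unique.filter⁺ _ (Unique.allFin⁺ l)
    into : map c (filterᵇ (q ∘ c) (allFin k)) ⊆ filterᵇ q (allFin l)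
    into ci∈ with ∈-map⁻ c ci∈
    ... | r , r∈ , refl = ∈-filterᵇ⁺ (∈-allFin (c r)) (proj₂ (∈-filterᵇ⁻ (allFin k) r∈))
    onto : filterᵇ q (allFin l) ⊆ map c (filterᵇ (q ∘ c) (allFin k))
    onto {i} i∈ with q⊆image i (proj₂ (∈-filterᵇ⁻ (allFin l) i∈))
    ... | r , refl = ∈-map⁺ c (∈-filterᵇ⁺ (∈-allFin r) (proj₂ (∈-filterᵇ⁻ (allFin l) i∈)))

lookup-⁅⁆-self : ∀ {k} (r : Fin k) → lookup ⁅ r ⁆ r ≡ true
lookup-⁅⁆-self r = []=⇒lookup (x∈⁅x⁆ r)

lookup-⁅⁆⁻ : ∀ {k} (r : Fin k) {s} → lookup ⁅ r ⁆ s ≡ true → s ≡ r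
lookup-⁅⁆⁻ r {s} e = x∈⁅y⁆⇒x≡y r (lookup⇒[]= s ⁅ r ⁆ e)

size-⁅⁆ : ∀ {k} (r : Fin k) → countF (lookup ⁅ r ⁆) ≡ 1
size-⁅⁆ r = countF-singleton _ r (lookup-⁅⁆-self r) (λ _ → lookup-⁅⁆⁻ r)

lookup-ext : ∀ {A : Set} {k} {xs ys : Vec A k} → (∀ i → lookup xs i ≡ lookup ys i) → xs ≡ ys
lookup-ext {xs = xs} {ys} same = trans (sym (tabulate∘lookup xs)) (trans (tabulate-cong same) (tabulate∘lookup ys))

image : ∀ {k l} → (Fin k → Fin l) → Subset k → Subset l
image c s = Vec.tabulate λ h → anyF λ r → lookup s r ∧ eqF (c r) h

lookup-image⁻ : ∀ {k l} (c : Fin k → Fin l) s h → lookup (image c s) h ≡ true →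
  ∃[ r ] lookup s r ≡ true × c r ≡ h
lookup-image⁻ c s h h∈ with anyF-elim _ (trans (sym (lookup∘tabulate _ h)) h∈)
... | r , r∈∧maps = r , ∧-conicalˡ _ _ r∈∧maps , eqF-true⁻ (∧-conicalʳ (lookup s r) _ r∈∧maps)

lookup-image : ∀ {k l} (c : Fin k → Fin l) → Injective _≡_ _≡_ c → ∀ s r →
  lookup (image c s) (c r) ≡ lookup s r
lookup-image c c-inj s r = trans (lookup∘tabulate _ (c r)) (bool-ext
  (λ any → case lookup-image⁻ c s (c r) (trans (lookup∘tabulate _ (c r)) any) of λ where
     (r' , r'∈ , same) → subst (λ t → lookup s t ≡ true) (c-inj same) r'∈)
  (λ r∈ → anyF-intro _ r (∧-intro r∈ (eqF-refl (c r)))))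

∈-allSubsets : ∀ {m} (s : Subset m) → s ∈ allSubsets m
∈-allSubsets []          = here refl
∈-allSubsets (true ∷ s)  = ∈-++⁺ˡ (∈-map⁺ (true ∷_) (∈-allSubsets s))
∈-allSubsets (false ∷ s) = ∈-++⁺ʳ (map (true ∷_) (allSubsets _)) (∈-map⁺ (false ∷_) (∈-allSubsets s))

allSubsets-Unique : ∀ m → Unique (allSubsets m)
allSubsets-Unique zero    = All.[] ∷ []
allSubsets-Unique (suc m) = Unique.++⁺ (prefixed true) (prefixed false) disjoint
  where
    prefixed : ∀ b → Unique (map (b ∷_) (allSubsets m))
    prefixed b = Unique.map⁺ ∷-injectiveʳ (allSubsets-Unique m)
    disjoint : ∀ {s} → ¬ (s ∈ map (true ∷_) (allSubsets m) × s ∈ map (false ∷_) (allSubsets m))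
    disjoint (s∈₁ , s∈₂) with ∈-map⁻ (true ∷_) s∈₁ | ∈-map⁻ (false ∷_) s∈₂
    ... | _ , _ , refl | _ , _ , ()

lookup-injective : ∀ {A : Set} {xs : List A} → Unique xs → Injective _≡_ _≡_ (List.lookup xs)
lookup-injective {xs = x ∷ xs} u        {zero}  {zero}  e = refl
lookup-injective {xs = x ∷ xs} (x∉ ∷ u) {zero}  {suc j} e = ⊥-elim (All.lookup x∉ (∈-lookup j) e)
lookup-injective {xs = x ∷ xs} (x∉ ∷ u) {suc i} {zero}  e = ⊥-elim (All.lookup x∉ (∈-lookup i) (sym e))
lookup-injective {xs = x ∷ xs} (x∉ ∷ u) {suc i} {suc j} e = cong suc (lookup-injective u e)

allPairs≡cartesianProduct : ∀ G → allPairs G ≡ cartesianProduct (allFin (Graph.n G)) (allFin (Graph.n G))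
allPairs≡cartesianProduct G = go (allFin (Graph.n G))
  where
    go : ∀ xs → concatMap (λ a → map (a ,_) (allFin (Graph.n G))) xs ≡ cartesianProduct xs (allFin (Graph.n G))
    go []       = refl
    go (x ∷ xs) = cong (map (x ,_) (allFin (Graph.n G)) ++_) (go xs)

hamming : ∀ {m} → (Fin m → Bool) → (Fin m → Bool) → ℕ
hamming x y = countF (λ i → x i xor y i)

hamming-self : ∀ {m} (x : Fin m → Bool) → hamming x x ≡ 0
hamming-self x = countF-none _ (λ i → xor-same (x i))

hamming≡0⇒≗ : ∀ {m} (x y : Fin m → Bool) → hamming x y ≡ 0 → ∀ i → x i ≡ y i
hamming≡0⇒≗ x y h≡0 i = xor-false⇒≡ (countF≡0⇒false _ h≡0 i)

differing-coordinate : ∀ {m} (x y : Fin m → Bool) → 0 < hamming x y →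
  ∃[ i ] x i xor y i ≡ true × (x i ≡ false ⊎ (∀ j → y j ≡ true → x j ≡ true))
differing-coordinate x y pos with anyF (λ i → y i ∧ not (x i)) in y∖x
... | false with countF-pos⇒∃ _ pos
...   | i , differs = i , differs , inj₂ λ j yⱼ →
  not-injective (trans (sym (cong (_∧ not (x j)) yⱼ)) (anyF-false⁻ _ y∖x j))
differing-coordinate x y pos | true with anyF-elim _ y∖x
... | i , yᵢ∧¬xᵢ = i , cong₂ _xor_ xᵢ yᵢ , inj₁ xᵢ
  where xᵢ = not-injective (∧-conicalʳ (y i) _ yᵢ∧¬xᵢ)
        yᵢ = ∧-conicalˡ _ _ yᵢ∧¬xᵢ

hamming-triangle : ∀ {m} (x y z : Fin m → Bool) → hamming x z ≤ hamming x y + hamming y z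
hamming-triangle x y z = ≤-trans (countF-mono _ _ (λ i → flip-somewhere (x i) (y i) (z i)))
                                  (countF-∨ (λ i → x i xor y i) (λ i → y i xor z i))
  where
    flip-somewhere : ∀ a b c → a xor c ≡ true → (a xor b) ∨ (b xor c) ≡ true
    flip-somewhere true  true  false _ = refl
    flip-somewhere true  false false _ = refl
    flip-somewhere false true  true  _ = refl
    flip-somewhere false false true  _ = refl

update-entry : ∀ {m} (y : Vec Bool m) i v j → lookup (y [ i ]≔ v) j ≡ true →
  (j ≡ i × v ≡ true) ⊎ lookup y j ≡ true
update-entry y i v j e = case j ≟ i of λ where
  (yes j≡i) → inj₁ (j≡i , trans (sym (lookup∘update i y v))
                                (subst (λ j → lookup (y [ i ]≔ v) j ≡ true) j≡i e))
  (no  j≢i) → inj₂ (trans (sym (lookup∘update′ j≢i y v)) e)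

module _ {m} (x y : Vec Bool m) (i : Fin m) (differs : lookup x i xor lookup y i ≡ true) where

  hamming-update-toward : suc (hamming (lookup x) (lookup (y [ i ]≔ lookup x i))) ≡ hamming (lookup x) (lookup y)
  hamming-update-toward = begin
    suc (hamming x′ t′)                     ≡⟨ +-comm 1 _ ⟩
    hamming x′ t′ + 1                       ≡⟨ cong (λ b → hamming x′ t′ + indicator b) differs ⟨
    hamming x′ t′ + indicator (x′ i xor y′ i) ≡⟨ countF-update _ _ i agree-off-i ⟨
    hamming x′ y′ + indicator (x′ i xor t′ i) ≡⟨ cong (λ b → hamming x′ y′ + indicator b) same-at-i ⟩
    hamming x′ y′ + 0                       ≡⟨ +-identityʳ _ ⟩
    hamming x′ y′                           ∎
    where
      open ≡-Reasoning
      x′ = lookup x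
      y′ = lookup y
      t′ = lookup (y [ i ]≔ lookup x i)
      same-at-i : x′ i xor t′ i ≡ false
      same-at-i = trans (cong (x′ i xor_) (lookup∘update i y (x′ i))) (xor-same (x′ i))
      agree-off-i : ∀ j → j ≢ i → x′ j xor y′ j ≡ x′ j xor t′ j
      agree-off-i j j≢i = cong (x′ j xor_) (sym (lookup∘update′ j≢i y (x′ i)))

  hamming-update-from : hamming (lookup (y [ i ]≔ lookup x i)) (lookup y) ≡ 1
  hamming-update-from = countF-singleton _ i
    (trans (cong (_xor lookup y i) (lookup∘update i y (lookup x i))) differs) only-i
    where
      only-i : ∀ j → lookup (y [ i ]≔ lookup x i) j xor lookup y j ≡ true → j ≡ i
      only-i j differsⱼ = case j ≟ i of λ where
        (yes j≡i) → j≡i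
        (no  j≢i) → ⊥-elim (true≢false (trans (sym differsⱼ)
                       (trans (cong (_xor lookup y j) (lookup∘update′ j≢i y (lookup x i))) (xor-same (lookup y j)))))

module Distance (G : Graph) (simple : IsSimple G) (connected : Connected G) where
  open Graph G

  reach-suc : ∀ k a b → reach G k a b ≡ true → reach G (suc k) a b ≡ true
  reach-suc k a b r rewrite r = refl

  reach-mono : ∀ {k l} a b → k ≤ l → reach G k a b ≡ true → reach G l a b ≡ true
  reach-mono {k} {l} a b k≤l r = subst (λ t → reach G t a b ≡ true) (m∸n+n≡m k≤l) (go (l ∸ k))
    where
      go : ∀ t → reach G (t + k) a b ≡ true
      go zero    = r
      go (suc t) = reach-suc (t + k) a b (go t)

  reach-step : ∀ k a c b → reach G k a c ≡ true → adj c b ≡ true → reach G (suc k) a b ≡ true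
  reach-step k a c b r e =
    ∨-trueʳ (reach G k a b) (anyF-intro (λ c → reach G k a c ∧ adj c b) c (trans (cong (_∧ adj c b) r) e))

  dist-minimal : ∀ k a b → reach G k a b ≡ true → dist G a b ≤ k
  dist-minimal k a b r = countF-bounded {n} (λ i → not (reach G (toℕ i) a b)) k below
    where
      below : ∀ i → not (reach G (toℕ i) a b) ≡ true → toℕ i < k
      below i unreached with k ≤? toℕ i
      ... | yes k≤i = ⊥-elim (true≢false (trans (sym (reach-mono a b k≤i r)) (not-injective unreached)))
      ... | no  k≰i = ≰⇒> k≰i

  dist-refl : ∀ a → dist G a a ≡ 0
  dist-refl a = n≤0⇒n≡0 (dist-minimal 0 a a (eqF-refl a))

  Stable : Fin n → ℕ → Set
  Stable a j = ∀ x → reach G j a x ≡ reach G (suc j) a x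

  stable-forever : ∀ a j → Stable a j → ∀ t x → reach G (t + j) a x ≡ reach G j a x
  stable-forever a j st zero    x = refl
  stable-forever a j st (suc t) x =
    trans (cong₂ _∨_ (ih x) (anyF-cong (λ c → cong (_∧ adj c x) (ih c)))) (sym (st x))
    where ih = stable-forever a j st t

  stable-or-growing : ∀ a k → (∃[ j ] j ≤ k × Stable a j) ⊎ (k < countF (reach G k a))
  stable-or-growing a zero = inj₂ (countF-pos _ a (eqF-refl a))
  stable-or-growing a (suc k) with stable-or-growing a k
  ... | inj₁ (j , j≤k , st) = inj₁ (j , m≤n⇒m≤1+n j≤k , st)
  ... | inj₂ grows with anyF (λ x → reach G (suc k) a x ∧ not (reach G k a x)) in new
  ...   | true with anyF-elim _ new
  ...     | x , x-new = inj₂ (≤-trans (s≤s grows)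
                          (countF-mono-strict _ _ (λ y → reach-suc k a y) x
                             (not-injective (∧-conicalʳ _ _ x-new)) (∧-conicalˡ _ _ x-new)))
  stable-or-growing a (suc k) | inj₂ _ | false = inj₁ (k , n≤1+n k , st)
    where
      st : Stable a k
      st x = bool-ext (reach-suc k a x) λ r-suc → ≢false⇒≡true λ r-k →
        true≢false (trans (sym (cong₂ _∧_ r-suc (cong not r-k))) (anyF-false⁻ _ new x))

  -- dist only counts radii below n, so every vertex must be reached within radius n - 1:
  -- the balls around a grow strictly until they stop growing for good.
  reach-within-n : ∀ a b K → n ≤ suc K → reach G K a b ≡ true
  reach-within-n a b K n≤1+K with stable-or-growing a K
  ... | inj₂ grows = countF-full _ (≤-trans n≤1+K grows) b
  ... | inj₁ (j , j≤K , st) with connected a b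
  ...   | k , r with k ≤? K
  ...     | yes k≤K = reach-mono a b k≤K r
  ...     | no  k≰K = reach-mono a b j≤K (trans (sym (stable-forever a j st (k ∸ j) b))
                        (subst (λ t → reach G t a b ≡ true) (sym (m∸n+n≡m j≤k)) r))
    where j≤k = ≤-trans j≤K (<⇒≤ (≰⇒> k≰K))

  reach-dist : ∀ a b → reach G (dist G a b) a b ≡ true
  reach-dist a b = ≢false⇒≡true λ unreached → case (suc (dist G a b) ≤? n) unreached
    where
      case : Dec (suc (dist G a b) ≤ n) → reach G (dist G a b) a b ≢ false
      case (no  d≮n) unreached = true≢false (trans (sym (reach-within-n a b _ (<⇒≤ (≰⇒> d≮n)))) unreached)
      case (yes d<n) unreached = 1+n≰n (countF-prefix _ (dist G a b) d<n prefix)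
        where
          prefix : ∀ i → toℕ i ≤ dist G a b → not (reach G (toℕ i) a b) ≡ true
          prefix i i≤d =
            cong not (≢true⇒≡false λ r → true≢false (trans (sym (reach-mono a b i≤d r)) unreached))

  dist≡0⇒≡ : ∀ a b → dist G a b ≡ 0 → a ≡ b
  dist≡0⇒≡ a b d≡0 = eqF-true⁻ (subst (λ t → reach G t a b ≡ true) d≡0 (reach-dist a b))

  reach-1 : ∀ a b → adj a b ≡ true → reach G 1 a b ≡ true
  reach-1 a b e = reach-step 0 a a b (eqF-refl a) e

  adj⇒dist≡1 : ∀ a b → adj a b ≡ true → dist G a b ≡ 1
  adj⇒dist≡1 a b e with dist G a b in d | dist-minimal 1 a b (reach-1 a b e)
  ... | zero  | _       =
    ⊥-elim (true≢false (trans (sym e) (subst (λ x → adj a x ≡ false) (dist≡0⇒≡ a b d) (proj₂ simple a))))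
  ... | suc zero | _    = refl
  ... | suc (suc _) | s≤s ()

  dist≡1⇒adj : ∀ a b → dist G a b ≡ 1 → adj a b ≡ true
  dist≡1⇒adj a b d≡1 with eqF a b in a≡b
  ... | true  =
    ⊥-elim (0≢1+n (trans (sym (dist-refl a)) (subst (λ x → dist G a x ≡ 1) (sym (eqF-true⁻ a≡b)) d≡1)))
  ... | false with anyF-elim (λ c → eqF a c ∧ adj c b)
                 (∨-true-resolve (subst (λ t → reach G t a b ≡ true) d≡1 (reach-dist a b)) a≡b)
  ...   | c , a≡c∧adj =
    subst (λ x → adj x b ≡ true) (sym (eqF-true⁻ (∧-conicalˡ _ _ a≡c∧adj))) (∧-conicalʳ _ _ a≡c∧adj)

  adj≡dist≡ᵇ1 : ∀ a b → adj a b ≡ (dist G a b ≡ᵇ 1)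
  adj≡dist≡ᵇ1 a b =
    bool-ext (λ e → ≡ᵇ-true (adj⇒dist≡1 a b e)) (λ e → dist≡1⇒adj a b (≡ᵇ-true⁻ e))

  dist-step : ∀ a c b → adj c b ≡ true → dist G a b ≤ suc (dist G a c)
  dist-step a c b e = dist-minimal (suc (dist G a c)) a b (reach-step (dist G a c) a c b (reach-dist a c) e)

  predecessor : ∀ u v d → dist G u v ≡ suc d → ∃[ c ] adj c v ≡ true × dist G u c ≡ d
  predecessor u v d d≡1+d with reach G d u v in r
  ... | true  = ⊥-elim (1+n≰n (subst (_≤ d) d≡1+d (dist-minimal d u v r)))
  ... | false with anyF-elim (λ c → reach G d u c ∧ adj c v)
                 (∨-true-resolve (subst (λ t → reach G t u v ≡ true) d≡1+d (reach-dist u v)) r)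
  ...   | c , rc∧adj = c , adj-cv , ≤-antisym (dist-minimal d u c (∧-conicalˡ _ _ rc∧adj))
                                      (≤-pred (subst (_≤ suc (dist G u c)) d≡1+d (dist-step u c v adj-cv)))
    where adj-cv = ∧-conicalʳ _ _ rc∧adj

-- The distances from a vertex to the two ends of an edge differ by one; P records which is smaller.
Offset : Bool → ℕ → ℕ → Set
Offset true  da db = suc da ≡ db
Offset false da db = da ≡ suc db

offset-<ᵇ : ∀ P {da db} → Offset P da db → (da <ᵇ db) ≡ P
offset-<ᵇ true  {da} refl = <ᵇ-true (n<1+n da)
offset-<ᵇ false {_} {db} refl = <ᵇ-false {suc db} {db} (n≤1+n db)

differ-by-2 : ∀ x y → x + y ≢ suc y + suc x
differ-by-2 x y e = m≢1+n+m (x + y) {1} (trans e (cong suc (trans (+-suc y x) (cong suc (+-comm y x)))))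

offset-Θ : ∀ P Q {ax bx ay by} → Offset P ax bx → Offset Q ay by → not ((ax + by) ≡ᵇ (ay + bx)) ≡ P xor Q
offset-Θ true  true  {ax} {_}  {ay} {_}  refl refl =
  cong not (≡ᵇ-true (trans (+-suc ax ay) (trans (cong suc (+-comm ax ay)) (sym (+-suc ay ax)))))
offset-Θ false false {_}  {bx} {_}  {by} refl refl = cong not (≡ᵇ-true (cong suc (+-comm bx by)))
offset-Θ true  false {ax} {_}  {_}  {by} refl refl = cong not (≡ᵇ-false (differ-by-2 ax by))
offset-Θ false true  {_}  {bx} {ay} {_}  refl refl = cong not (≡ᵇ-false (differ-by-2 ay bx ∘ sym))

offset-from-update : ∀ da db pa pb pw → pa xor pb ≡ true →
  da + indicator (pb xor pw) ≡ db + indicator (pa xor pw) → Offset (not (pw xor pa)) da db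
offset-from-update da db true  false true  _ e = trans (+-comm 1 da) (trans e (+-identityʳ db))
offset-from-update da db true  false false _ e = trans (sym (+-identityʳ da)) (trans e (+-comm db 1))
offset-from-update da db false true  true  _ e = trans (sym (+-identityʳ da)) (trans e (+-comm db 1))
offset-from-update da db false true  false _ e = trans (+-comm 1 da) (trans e (+-identityʳ db))

module IsometricEmbedding (G : Graph) (simple : IsSimple G) (connected : Connected G)
  {m : ℕ} (g : Fin (Graph.n G) → Fin m → Bool) (isometric : ∀ a b → hamming (g a) (g b) ≡ dist G a b) where
  open Graph G
  open Distance G simple connected

  Flips : Fin m → Fin n → Fin n → Set
  Flips i a b = g a i xor g b i ≡ true

  edge-flips : ∀ a b → adj a b ≡ true → ∃[ i ] Flips i a b
  edge-flips a b e = countF-pos⇒∃ _ (≤-reflexive (sym (trans (isometric a b) (adj⇒dist≡1 a b e))))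

  edge-flips-unique : ∀ a b → adj a b ≡ true → ∀ i j → Flips i a b → Flips j a b → i ≡ j
  edge-flips-unique a b e = countF≡1⇒unique _ (trans (isometric a b) (adj⇒dist≡1 a b e))

  edge-fixes-others : ∀ a b → adj a b ≡ true → ∀ i → Flips i a b → ∀ j → j ≢ i → g a j ≡ g b j
  edge-fixes-others a b e i flips j j≢i =
    xor-false⇒≡ (≢true⇒≡false λ flipsⱼ → j≢i (edge-flips-unique a b e j i flipsⱼ flips))

  edge-offset : ∀ a b → adj a b ≡ true → ∀ i → Flips i a b → ∀ w →
    Offset (not (g w i xor g a i)) (dist G a w) (dist G b w)
  edge-offset a b e i flips w = offset-from-update _ _ (g a i) (g b i) (g w i) flips
    (subst₂ (λ da db → da + indicator (g b i xor g w i) ≡ db + indicator (g a i xor g w i))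
            (isometric a w) (isometric b w)
            (countF-update _ _ i (λ j j≢i → cong (_xor g w j) (edge-fixes-others a b e i flips j j≢i))))

  W-coordinate : ∀ a b → adj a b ≡ true → ∀ i → Flips i a b → ∀ w →
    Wb G a b w ≡ not (g w i xor g a i)
  W-coordinate a b e i flips w = offset-<ᵇ _ (edge-offset a b e i flips w)

  Θ-coordinate : ∀ a b → adj a b ≡ true → ∀ i → Flips i a b → ∀ x y →
    Θb G a b x y ≡ (g x i xor g y i)
  Θ-coordinate a b e i flips x y =
    trans (offset-Θ _ _ (edge-offset a b e i flips x) (edge-offset a b e i flips y))
          (xor-not-cancel (g x i) (g y i) (g a i))

module Cliques (H : Graph) where
  open Graph H

  IsClique : Subset n → Set
  IsClique s = ∀ i j → lookup s i ≡ true → lookup s j ≡ true → i ≢ j → adj i j ≡ true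

  clique-intro : ∀ s → IsClique s → isClique H s ≡ true
  clique-intro s cl = allF-intro _ λ i → allF-intro _ λ j →
    entry (lookup s i) (lookup s j) (eqF i j) (adj i j)
      (λ sᵢ sⱼ i≢j → cl i j sᵢ sⱼ λ i≡j →
        true≢false (trans (sym (subst (λ j → eqF i j ≡ true) i≡j (eqF-refl i))) i≢j))
    where
      entry : ∀ p q e a → (p ≡ true → q ≡ true → e ≡ false → a ≡ true) →
              not (p ∧ q ∧ not e) ∨ a ≡ true
      entry true  true  false a h = h refl refl refl
      entry true  true  true  a h = refl
      entry true  false e     a h = refl
      entry false q     e     a h = refl

  clique-elim : ∀ s → isClique H s ≡ true → IsClique s
  clique-elim s cl i j sᵢ sⱼ i≢j = ∨-true-resolve (allF-elim _ (allF-elim _ cl i) j) (cong not both)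
    where
      both : lookup s i ∧ lookup s j ∧ not (eqF i j) ≡ true
      both rewrite sᵢ | sⱼ | eqF-false i≢j = refl

  subset-clique : ∀ s t → isClique H s ≡ true → (∀ i → lookup t i ≡ true → lookup s i ≡ true) →
    isClique H t ≡ true
  subset-clique s t cl t⊆s = clique-intro t λ i j tᵢ tⱼ → clique-elim s cl i j (t⊆s i tᵢ) (t⊆s j tⱼ)

  update-clique : ∀ x y i → isClique H x ≡ true → isClique H y ≡ true →
    lookup x i ≡ false ⊎ (∀ j → lookup y j ≡ true → lookup x j ≡ true) →
    isClique H (y [ i ]≔ lookup x i) ≡ true
  update-clique x y i x-clique y-clique (inj₁ x∌i) = subset-clique y (y [ i ]≔ lookup x i) y-clique λ j tⱼ →
    case update-entry y i (lookup x i) j tⱼ of λ where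
      (inj₁ (_ , x∋i)) → ⊥-elim (true≢false (trans (sym x∋i) x∌i))
      (inj₂ y∋j)       → y∋j
  update-clique x y i x-clique y-clique (inj₂ y⊆x) = subset-clique x (y [ i ]≔ lookup x i) x-clique λ j tⱼ →
    case update-entry y i (lookup x i) j tⱼ of λ where
      (inj₁ (j≡i , x∋i)) → subst (λ j → lookup x j ≡ true) (sym j≡i) x∋i
      (inj₂ y∋j)         → y⊆x j y∋j

  singleton-clique : ∀ s → countF (lookup s) ≡ 1 → isClique H s ≡ true
  singleton-clique s size≡1 =
    clique-intro s λ i j sᵢ sⱼ i≢j → ⊥-elim (i≢j (countF≡1⇒unique _ size≡1 i j sᵢ sⱼ))

module SimplexGraphIsometry (G : Graph) (simple : IsSimple G) (connected : Connected G)
  (H : Graph) (φ : Fin (Graph.n G) → Subset (Graph.n H)) (φ-injective : ∀ a b → φ a ≡ φ b → a ≡ b)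
  (φ-clique : ∀ a → isClique H (φ a) ≡ true) (φ-onto : ∀ s → isClique H s ≡ true → ∃[ a ] φ a ≡ s)
  (φ-adj : ∀ a b → Graph.adj G a b ≡ simplexAdj H (φ a) (φ b)) where
  open Graph G
  open Distance G simple connected
  open Cliques H using (update-clique)

  g : Fin n → Fin (Graph.n H) → Bool
  g a = lookup (φ a)

  adj⇒hamming≡1 : ∀ a b → adj a b ≡ true → hamming (g a) (g b) ≡ 1
  adj⇒hamming≡1 a b e = ≡ᵇ-true⁻ (trans (sym (φ-adj a b)) e)

  hamming≤reach : ∀ k a b → reach G k a b ≡ true → hamming (g a) (g b) ≤ k
  hamming≤reach zero    a b r rewrite eqF-true⁻ {i = a} {b} r = ≤-reflexive (hamming-self (g b))
  hamming≤reach (suc k) a b r with reach G k a b in r-k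
  ... | true  = m≤n⇒m≤1+n (hamming≤reach k a b r-k)
  ... | false with anyF-elim (λ c → reach G k a c ∧ adj c b) r
  ...   | c , r-c∧adj = begin
    hamming (g a) (g b)                        ≤⟨ hamming-triangle (g a) (g c) (g b) ⟩
    hamming (g a) (g c) + hamming (g c) (g b)  ≤⟨ +-mono-≤ (hamming≤reach k a c (∧-conicalˡ _ _ r-c∧adj))
                                                    (≤-reflexive (adj⇒hamming≡1 c b (∧-conicalʳ _ _ r-c∧adj))) ⟩
    k + 1                                      ≡⟨ +-comm k 1 ⟩
    suc k                                      ∎
    where open ≤-Reasoning

  closer-neighbour : ∀ k a b → hamming (g a) (g b) ≡ suc k → ∃[ c ] hamming (g a) (g c) ≡ k × adj c b ≡ true
  closer-neighbour k a b h≡1+k = c , h-ac , adj-cb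
    where
      differing = differing-coordinate (g a) (g b) (≤-trans (s≤s z≤n) (≤-reflexive (sym h≡1+k)))
      i = proj₁ differing
      differs = proj₁ (proj₂ differing)
      t = φ b [ i ]≔ g a i
      found = φ-onto t (update-clique (φ a) (φ b) i (φ-clique a) (φ-clique b) (proj₂ (proj₂ differing)))
      c = proj₁ found
      h-ac : hamming (g a) (g c) ≡ k
      h-ac = suc-injective (trans (cong (λ s → suc (hamming (g a) (lookup s))) (proj₂ found))
                                  (trans (hamming-update-toward (φ a) (φ b) i differs) h≡1+k))
      adj-cb : adj c b ≡ true
      adj-cb = trans (φ-adj c b) (≡ᵇ-true (trans (cong (λ s → hamming (lookup s) (g b)) (proj₂ found))
                                                 (hamming-update-from (φ a) (φ b) i differs)))

  reach-hamming : ∀ k a b → hamming (g a) (g b) ≡ k → reach G k a b ≡ true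
  reach-hamming zero    a b h≡0 = subst (λ b → reach G 0 a b ≡ true)
    (φ-injective a b (lookup-ext (hamming≡0⇒≗ (g a) (g b) h≡0))) (eqF-refl a)
  reach-hamming (suc k) a b h≡1+k with closer-neighbour k a b h≡1+k
  ... | c , h-ac , adj-cb = reach-step k a c b (reach-hamming k a c h-ac) adj-cb

  φ-isometric : ∀ a b → hamming (g a) (g b) ≡ dist G a b
  φ-isometric a b = ≤-antisym (hamming≤reach (dist G a b) a b (reach-dist a b))
                              (dist-minimal _ a b (reach-hamming _ a b refl))

module _ {V C : Set} where

  Patterns : (V → C → Bool) → C → C → Set
  Patterns h r s = ∀ α β → ∃[ w ] h w r ≡ α × h w s ≡ β

  patterns-sym : ∀ {h r s} → Patterns h r s → Patterns h s r
  patterns-sym pat α β with pat β α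
  ... | w , hr , hs = w , hs , hr

  patterns-irreflexive : ∀ {h r} → ¬ Patterns h r r
  patterns-irreflexive pat with pat true false
  ... | w , ht , hf = true≢false (trans (sym ht) hf)

  patterns-xor : ∀ {h h' r s} (c : C → Bool) → (∀ w t → h' w t ≡ c t xor h w t) →
    Patterns h r s → Patterns h' r s
  patterns-xor {h} {h'} {r} {s} c h'≡ pat α β with pat (c r xor α) (c s xor β)
  ... | w , hr , hs = w , shift r hr , shift s hs
    where
      shift : ∀ t {γ} → h w t ≡ c t xor γ → h' w t ≡ γ
      shift t {γ} e = trans (h'≡ w t) (trans (cong (c t xor_) e) (xor-involutiveˡ (c t) γ))

module PartialCube (G : Graph) (simple : IsSimple G) (partialCube : IsPartialCube G) where
  open Graph G

  m : ℕ
  m = proj₁ (proj₂ partialCube)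

  f : Fin n → Fin m → Bool
  f = proj₁ (proj₂ (proj₂ partialCube))

  f-isometric : ∀ a b → hamming (f a) (f b) ≡ dist G a b
  f-isometric = proj₂ (proj₂ (proj₂ partialCube))

  open Distance G simple (proj₁ partialCube) public
  open IsometricEmbedding G simple (proj₁ partialCube) f f-isometric public

  adj-sym : ∀ a b → adj a b ≡ true → adj b a ≡ true
  adj-sym a b e = trans (proj₁ simple b a) e

  W-swap : ∀ a b → adj a b ≡ true → ∀ w → Wb G b a w ≡ not (Wb G a b w)
  W-swap a b e w with edge-flips a b e
  ... | i , flips = trans (W-coordinate b a (adj-sym a b e) i (trans (xor-comm (f b i) (f a i)) flips) w)
                          (trans (opposite (f w i) (f a i) (f b i) flips) (cong not (sym (W-coordinate a b e i flips w))))
    where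
      opposite : ∀ w a b → a xor b ≡ true → not (w xor b) ≡ not (not (w xor a))
      opposite true  true  false _ = refl
      opposite true  false true  _ = refl
      opposite false true  false _ = refl
      opposite false false true  _ = refl

  rank : Fin n → Fin n → ℕ
  rank x y = toℕ x * n + toℕ y

  lexLt⇒rank< : ∀ x' y' x y → lexLt G x' y' x y ≡ true → rank x' y' < rank x y
  lexLt⇒rank< x' y' x y lt with toℕ x' <ᵇ toℕ x in x'<x
  ... | true  = begin-strict
    toℕ x' * n + toℕ y'  <⟨ +-monoʳ-< (toℕ x' * n) (Fin.toℕ<n y') ⟩
    toℕ x' * n + n       ≡⟨ +-comm (toℕ x' * n) n ⟩
    suc (toℕ x') * n     ≤⟨ *-monoˡ-≤ n (<ᵇ-true⁻ {toℕ x'} {toℕ x} x'<x) ⟩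
    toℕ x * n            ≤⟨ m≤m+n (toℕ x * n) (toℕ y) ⟩
    toℕ x * n + toℕ y    ∎
    where open ≤-Reasoning
  ... | false with eqF-true⁻ {i = x'} {x} (∧-conicalˡ _ _ lt)
  ...   | refl = +-monoʳ-< (toℕ x * n) (<ᵇ-true⁻ (∧-conicalʳ (eqF x x) _ lt))

  lexLt-fst : ∀ {x x'} y y' → toℕ x < toℕ x' → lexLt G x y x' y' ≡ true
  lexLt-fst {x} {x'} y y' x<x' = cong (_∨ (eqF x x' ∧ (toℕ y <ᵇ toℕ y'))) (<ᵇ-true x<x')

  lexLt-snd : ∀ x {y y'} → toℕ y < toℕ y' → lexLt G x y x y' ≡ true
  lexLt-snd x {y} {y'} y<y' = ∨-trueʳ (toℕ x <ᵇ toℕ x) (cong₂ _∧_ (eqF-refl x) (<ᵇ-true y<y'))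

  lex-trichotomy : ∀ x y x' y' → lexLt G x y x' y' ≡ true ⊎ lexLt G x' y' x y ≡ true ⊎ (x ≡ x' × y ≡ y')
  lex-trichotomy x y x' y' with <-cmp (toℕ x) (toℕ x')
  ... | tri< x<x' _ _ = inj₁ (lexLt-fst y y' x<x')
  ... | tri> _ _ x>x' = inj₂ (inj₁ (lexLt-fst y' y x>x'))
  ... | tri≈ _ x≡x' _ with Fin.toℕ-injective x≡x'
  ...   | refl with <-cmp (toℕ y) (toℕ y')
  ...     | tri< y<y' _ _ = inj₁ (lexLt-snd x y<y')
  ...     | tri> _ _ y>y' = inj₂ (inj₁ (lexLt-snd x y>y'))
  ...     | tri≈ _ y≡y' _ = inj₂ (inj₂ (refl , Fin.toℕ-injective y≡y'))

  OrderedEdge : Fin n → Fin n → Set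
  OrderedEdge x y = adj x y ≡ true × (toℕ x <ᵇ toℕ y) ≡ true

  SmallerInClass : Fin n → Fin n → Fin n → Fin n → Bool
  SmallerInClass x y x' y' = adj x' y' ∧ (toℕ x' <ᵇ toℕ y') ∧ Θb G x y x' y' ∧ lexLt G x' y' x y

  canonical-unfold : ∀ x y → OrderedEdge x y →
    canonical G x y ≡ not (anyF λ x' → anyF λ y' → SmallerInClass x y x' y')
  canonical-unfold x y (e , o) rewrite e | o = refl

  canonical-minimal : ∀ x y x' y' → canonical G x y ≡ true → OrderedEdge x' y' →
    Θb G x y x' y' ≡ true → lexLt G x' y' x y ≢ true
  canonical-minimal x y x' y' can (e' , o') θ lt = true≢false (trans (sym smaller) none)
    where
      smaller = anyF-intro _ x' (anyF-intro _ y' (∧-intro e' (∧-intro o' (∧-intro θ lt))))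
      none = not-injective (∧-conicalʳ _ _ (∧-conicalʳ (adj x y) _ can))

  not-canonical⇒smaller : ∀ x y → OrderedEdge x y → canonical G x y ≡ false →
    ∃[ x' ] ∃[ y' ] OrderedEdge x' y' × Θb G x y x' y' ≡ true × lexLt G x' y' x y ≡ true
  not-canonical⇒smaller x y xy not-can
    with anyF-elim _ (not-injective (trans (sym (canonical-unfold x y xy)) not-can))
  ... | x' , any-y' with anyF-elim _ any-y'
  ...   | y' , smaller with ∧₄-elim {adj x' y'} {toℕ x' <ᵇ toℕ y'} {Θb G x y x' y'} smaller
  ...     | e' , o' , θ , lt = x' , y' , (e' , o') , θ , lt

  #classes : ℕ
  #classes = length (classReps G)

  Class : Set
  Class = Fin #classes

  rep₁ rep₂ : Class → Fin n
  rep₁ r = proj₁ (List.lookup (classReps G) r)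
  rep₂ r = proj₂ (List.lookup (classReps G) r)

  rep-canonical : ∀ r → canonical G (rep₁ r) (rep₂ r) ≡ true
  rep-canonical r = proj₂ (∈-filterᵇ⁻ (allPairs G) (∈-lookup r))

  rep-ordered : ∀ r → OrderedEdge (rep₁ r) (rep₂ r)
  rep-ordered r = ∧-conicalˡ _ _ (rep-canonical r) ,
                  ∧-conicalˡ _ _ (∧-conicalʳ (adj (rep₁ r) (rep₂ r)) _ (rep-canonical r))

  rep-adj : ∀ r → adj (rep₁ r) (rep₂ r) ≡ true
  rep-adj r = proj₁ (rep-ordered r)

  canonical⇒∈classReps : ∀ x y → canonical G x y ≡ true → (x , y) ∈ classReps G
  canonical⇒∈classReps x y can = ∈-filterᵇ⁺
    (subst ((x , y) ∈_) (sym (allPairs≡cartesianProduct G)) (∈-cartesianProduct⁺ (∈-allFin x) (∈-allFin y))) can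

  classReps-Unique : Unique (classReps G)
  classReps-Unique = Unique.filter⁺ _ (subst Unique (sym (allPairs≡cartesianProduct G))
    (Unique.cartesianProduct⁺ (Unique.allFin⁺ n) (Unique.allFin⁺ n)))

  coord : Class → Fin m
  coord r = proj₁ (edge-flips _ _ (rep-adj r))

  coord-flips : ∀ r → Flips (coord r) (rep₁ r) (rep₂ r)
  coord-flips r = proj₂ (edge-flips _ _ (rep-adj r))

  Θ-related-reps-equal : ∀ r s → Θb G (rep₁ r) (rep₂ r) (rep₁ s) (rep₂ s) ≡ true →
    Θb G (rep₁ s) (rep₂ s) (rep₁ r) (rep₂ r) ≡ true → r ≡ s
  Θ-related-reps-equal r s θrs θsr with lex-trichotomy (rep₁ s) (rep₂ s) (rep₁ r) (rep₂ r)
  ... | inj₁ s<r              = ⊥-elim (canonical-minimal _ _ _ _ (rep-canonical r) (rep-ordered s) θrs s<r)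
  ... | inj₂ (inj₁ r<s)       = ⊥-elim (canonical-minimal _ _ _ _ (rep-canonical s) (rep-ordered r) θsr r<s)
  ... | inj₂ (inj₂ (e₁ , e₂)) = lookup-injective classReps-Unique (sym (cong₂ _,_ e₁ e₂))

  reps-flipping-same-equal : ∀ {k} (h : Fin n → Fin k → Bool) → (∀ a b → hamming (h a) (h b) ≡ dist G a b) →
    ∀ r s i → h (rep₁ r) i xor h (rep₂ r) i ≡ true → h (rep₁ s) i xor h (rep₂ s) i ≡ true → r ≡ s
  reps-flipping-same-equal h h-isometric r s i flips-r flips-s =
    Θ-related-reps-equal r s (trans (h-embedding.Θ-coordinate _ _ (rep-adj r) i flips-r _ _) flips-s)
                             (trans (h-embedding.Θ-coordinate _ _ (rep-adj s) i flips-s _ _) flips-r)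
    where module h-embedding = IsometricEmbedding G simple (proj₁ partialCube) h h-isometric

  coord-injective : Injective _≡_ _≡_ coord
  coord-injective {r} {s} same = reps-flipping-same-equal f f-isometric r s (coord r) (coord-flips r)
    (subst (λ i → Flips i (rep₁ s) (rep₂ s)) (sym same) (coord-flips s))

  flipping-edge : ∀ i a d v → dist G a v ≡ d → Flips i a v → ∃[ x ] ∃[ y ] adj x y ≡ true × Flips i x y
  flipping-edge i a zero    v d≡0 flips with dist≡0⇒≡ a v d≡0
  ... | refl = ⊥-elim (true≢false (trans (sym flips) (xor-same (f a i))))
  flipping-edge i a (suc d) v d≡1+d flips with predecessor a v d d≡1+d
  ... | c , adj-cv , d-ac with f c i xor f v i in flips-cv
  ...   | true  = c , v , adj-cv , flips-cv
  ...   | false = flipping-edge i a d c d-ac (trans (cong (f a i xor_) (xor-false⇒≡ flips-cv)) flips)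

  orient : ∀ i x y → adj x y ≡ true → Flips i x y → ∃[ x' ] ∃[ y' ] OrderedEdge x' y' × Flips i x' y'
  orient i x y e flips with <-cmp (toℕ x) (toℕ y)
  ... | tri< x<y _ _ = x , y , (e , <ᵇ-true x<y) , flips
  ... | tri> _ _ x>y = y , x , (adj-sym x y e , <ᵇ-true x>y) , trans (xor-comm (f y i) (f x i)) flips
  ... | tri≈ _ x≡y _ with Fin.toℕ-injective x≡y
  ...   | refl = ⊥-elim (true≢false (trans (sym e) (proj₂ simple x)))

  canonical-flip : ∀ i x y → Acc _<_ (rank x y) → OrderedEdge x y → Flips i x y →
    ∃[ x' ] ∃[ y' ] canonical G x' y' ≡ true × Flips i x' y'
  canonical-flip i x y (acc smaller) xy flips with canonical G x y in can
  ... | true  = x , y , can , flips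
  ... | false with not-canonical⇒smaller x y xy can
  ...   | x' , y' , xy' , θ , lt =
    canonical-flip i x' y' (smaller (lexLt⇒rank< x' y' x y lt)) xy'
      (trans (sym (Θ-coordinate x y (proj₁ xy) i flips x' y')) θ)

  coord-surjective : ∀ i a b → Flips i a b → ∃[ r ] coord r ≡ i
  coord-surjective i a b flips with flipping-edge i a (dist G a b) b refl flips
  ... | x , y , e , flips-xy with orient i x y e flips-xy
  ...   | x' , y' , xy' , flips-xy' with canonical-flip i x' y' (<-wellFounded (rank x' y')) xy' flips-xy'
  ...     | x″ , y″ , can , flips-xy″ = index x″y″∈ , same-coord
    where
      x″y″∈ = canonical⇒∈classReps x″ y″ can
      rep≡ : (x″ , y″) ≡ List.lookup (classReps G) (index x″y″∈)
      rep≡ = lookup-index x″y″∈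
      same-coord : coord (index x″y″∈) ≡ i
      same-coord = edge-flips-unique _ _ (rep-adj (index x″y″∈)) _ i (coord-flips (index x″y″∈))
        (subst (λ p → Flips i (proj₁ p) (proj₂ p)) rep≡ flips-xy″)

  inW : Fin n → Class → Bool
  inW w r = Wb G (rep₁ r) (rep₂ r) w

  inW-xor : ∀ a b r → inW a r xor inW b r ≡ f a (coord r) xor f b (coord r)
  inW-xor a b r = trans (cong₂ _xor_ (W-coordinate _ _ (rep-adj r) _ (coord-flips r) a)
                                     (W-coordinate _ _ (rep-adj r) _ (coord-flips r) b))
                        (xor-not-cancel (f a (coord r)) (f b (coord r)) (f (rep₁ r) (coord r)))

  classes-isometric : ∀ a b → hamming (inW a) (inW b) ≡ dist G a b
  classes-isometric a b = begin
    hamming (inW a) (inW b)                          ≡⟨ countF-cong (inW-xor a b) ⟩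
    countF (λ r → f a (coord r) xor f b (coord r))   ≡⟨ countF-reindex coord coord-injective (λ i → f a i xor f b i)
                                                          (λ i flips → coord-surjective i a b flips) ⟩
    hamming (f a) (f b)                              ≡⟨ f-isometric a b ⟩
    dist G a b                                       ∎
    where open ≡-Reasoning

  inW-swap : ∀ w r → Wb G (rep₂ r) (rep₁ r) w ≡ not (inW w r)
  inW-swap w r = W-swap _ _ (rep-adj r) w

  G# : Graph
  G# = crossingGraph G

  Pattern : Class → Class → Bool → Bool → Bool
  Pattern r s α β = anyF (λ w → matches α (inW w r) ∧ matches β (inW w s))

  crossing-adj≡ : ∀ r s → Graph.adj G# r s ≡
    Pattern r s true true ∧ Pattern r s false true ∧ Pattern r s true false ∧ Pattern r s false false
  crossing-adj≡ r s = cong (Pattern r s true true ∧_) (cong₂ _∧_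
    (anyF-cong λ w → cong (_∧ inW w s) (inW-swap w r)) (cong₂ _∧_
    (anyF-cong λ w → cong (inW w r ∧_) (inW-swap w s))
    (anyF-cong λ w → cong₂ _∧_ (inW-swap w r) (inW-swap w s))))

  pattern-intro : ∀ r s α β w → inW w r ≡ α → inW w s ≡ β → Pattern r s α β ≡ true
  pattern-intro r s α β w wr ws = anyF-intro _ w (∧-intro (matches-true α wr) (matches-true β ws))

  pattern-elim : ∀ r s α β → Pattern r s α β ≡ true → ∃[ w ] inW w r ≡ α × inW w s ≡ β
  pattern-elim r s α β pat with anyF-elim _ pat
  ... | w , both = w , matches-true⁻ α (∧-conicalˡ _ _ both) , matches-true⁻ β (∧-conicalʳ _ _ both)

  crosses⇔patterns : ∀ r s → Graph.adj G# r s ≡ true ⇔ Patterns inW r s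
  crosses⇔patterns r s = mk⇔ to from
    where
      AllFour : Set
      AllFour = Pattern r s true true ≡ true × Pattern r s false true ≡ true ×
                Pattern r s true false ≡ true × Pattern r s false false ≡ true
      pick : AllFour → Patterns inW r s
      pick (tt , _  , _  , _ ) true  true  = pattern-elim r s true  true  tt
      pick (_  , ft , _  , _ ) false true  = pattern-elim r s false true  ft
      pick (_  , _  , tf , _ ) true  false = pattern-elim r s true  false tf
      pick (_  , _  , _  , ff) false false = pattern-elim r s false false ff
      to : Graph.adj G# r s ≡ true → Patterns inW r s
      to crosses = pick (∧₄-elim {Pattern r s true true} {Pattern r s false true} {Pattern r s true false}
                                 (trans (sym (crossing-adj≡ r s)) crosses))
      from : Patterns inW r s → Graph.adj G# r s ≡ true
      from pat = trans (crossing-adj≡ r s)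
        (∧-intro (intro true true) (∧-intro (intro false true) (∧-intro (intro true false) (intro false false))))
        where
          intro : ∀ α β → Pattern r s α β ≡ true
          intro α β with pat α β
          ... | w , wr , ws = pattern-intro r s α β w wr ws

  G#-simple : IsSimple G#
  G#-simple = (λ r s → bool-ext (crossing-sym r s) (crossing-sym s r)) ,
              (λ r → ≢true⇒≡false (patterns-irreflexive {h = inW} ∘ Equivalence.to (crosses⇔patterns r r)))
    where
      crossing-sym : ∀ r s → Graph.adj G# r s ≡ true → Graph.adj G# s r ≡ true
      crossing-sym r s =
        Equivalence.from (crosses⇔patterns s r) ∘ patterns-sym {h = inW} ∘ Equivalence.to (crosses⇔patterns r s)

  module Rooted (u : Fin n) where
    open Cliques G#

    -- separatingSet w is the clique of G# that w corresponds to in S(G#).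
    separates : Fin n → Class → Bool
    separates w r = inW u r xor inW w r

    separatingSet : Fin n → Subset #classes
    separatingSet w = Vec.tabulate (separates w)

    lookup-separatingSet : ∀ w r → lookup (separatingSet w) r ≡ separates w r
    lookup-separatingSet w = lookup∘tabulate (separates w)

    separates-isometric : ∀ a b → hamming (separates a) (separates b) ≡ dist G a b
    separates-isometric a b =
      trans (countF-cong λ r → xor-cancel-common (inW u r) (inW a r) (inW b r)) (classes-isometric a b)

    separatingSet-hamming : ∀ a b → hamming (lookup (separatingSet a)) (lookup (separatingSet b)) ≡ dist G a b
    separatingSet-hamming a b =
      trans (countF-cong λ r → cong₂ _xor_ (lookup-separatingSet a r) (lookup-separatingSet b r))
            (separates-isometric a b)

    separates-root : ∀ r → separates u r ≡ false
    separates-root r = xor-same (inW u r)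

    size-separates : ∀ w → countF (separates w) ≡ dist G u w
    size-separates w =
      trans (countF-cong λ r → cong (_xor separates w r) (sym (separates-root r))) (separates-isometric u w)

    size-separatingSet : ∀ w → size G# (separatingSet w) ≡ dist G u w
    size-separatingSet w = trans (countF-cong (lookup-separatingSet w)) (size-separates w)

    separatingSet-root : separatingSet u ≡ Subset.⊥
    separatingSet-root = lookup-ext λ r →
      trans (lookup-separatingSet u r) (trans (separates-root r) (sym (lookup-replicate r false)))

    separatingSet-injective : Injective _≡_ _≡_ separatingSet
    separatingSet-injective {a} {b} same = dist≡0⇒≡ a b (trans (sym (separatingSet-hamming a b))
      (subst (λ s → hamming (lookup s) (lookup (separatingSet b)) ≡ 0) (sym same)
             (hamming-self (lookup (separatingSet b)))))

    adj≡simplexAdj : ∀ a b → adj a b ≡ simplexAdj G# (separatingSet a) (separatingSet b)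
    adj≡simplexAdj a b = trans (adj≡dist≡ᵇ1 a b) (cong (_≡ᵇ 1) (sym (separatingSet-hamming a b)))

    crosses⇔separated : ∀ r s → Graph.adj G# r s ≡ true ⇔ Patterns separates r s
    crosses⇔separated r s = mk⇔
      (patterns-xor (inW u) (λ _ _ → refl) ∘ Equivalence.to (crosses⇔patterns r s))
      (Equivalence.from (crosses⇔patterns r s) ∘
         patterns-xor (inW u) (λ w t → sym (xor-involutiveˡ (inW u t) (inW w t))))

    level : ℕ → List (Fin n)
    level d = filterᵇ (λ v → dist G u v ≡ᵇ d) (allFin n)

    cliquesOfSize : ℕ → List (Subset #classes)
    cliquesOfSize d = filterᵇ (λ s → isClique G# s ∧ (size G# s ≡ᵇ d)) (allSubsets #classes)

    LevelOfCliques : ℕ → Set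
    LevelOfCliques d = ∀ v → dist G u v ≡ d → isClique G# (separatingSet v) ≡ true

    ∈-cliquesOfSize : ∀ {d} s → isClique G# s ≡ true → size G# s ≡ d → s ∈ cliquesOfSize d
    ∈-cliquesOfSize s clique size≡d = ∈-filterᵇ⁺ (∈-allSubsets s) (∧-intro clique (≡ᵇ-true size≡d))

    level⊆cliquesOfSize : ∀ {d} → LevelOfCliques d → map separatingSet (level d) ⊆ cliquesOfSize d
    level⊆cliquesOfSize cliques s∈ with ∈-map⁻ separatingSet s∈
    ... | v , v∈ , refl = ∈-cliquesOfSize (separatingSet v) (cliques v dist≡) (trans (size-separatingSet v) dist≡)
      where dist≡ = ≡ᵇ-true⁻ (proj₂ (∈-filterᵇ⁻ (allFin n) v∈))

    separatingSets-Unique : ∀ d → Unique (map separatingSet (level d))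
    separatingSets-Unique d = Unique.map⁺ separatingSet-injective (Unique.filter⁺ _ (Unique.allFin⁺ n))

    length-level : ∀ d → length (map separatingSet (level d)) ≡ wCoeff G u d
    length-level d =
      trans (length-map separatingSet (level d)) (length-filterᵇ-tabulate {k = n} id (λ v → dist G u v ≡ᵇ d))

    coefficients-agree : ∀ d → LevelOfCliques d →
      (∀ s → isClique G# s ≡ true → size G# s ≡ d → ∃[ v ] separatingSet v ≡ s) →
      wCoeff G u d ≡ clCoeff G# d
    coefficients-agree d cliques onto = trans (sym (length-level d))
      (Unique-⊆-⊇⇒length≡ (separatingSets-Unique d) (Unique.filter⁺ _ (allSubsets-Unique #classes))
        (level⊆cliquesOfSize cliques) cliquesOfSize⊆)
      where
        cliquesOfSize⊆ : cliquesOfSize d ⊆ map separatingSet (level d)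
        cliquesOfSize⊆ {s} s∈ = subst (_∈ map separatingSet (level d)) v↦s (∈-map⁺ separatingSet v∈level)
          where
            clique∧size = proj₂ (∈-filterᵇ⁻ (allSubsets #classes) s∈)
            clique = ∧-conicalˡ _ _ clique∧size
            size≡d = ≡ᵇ-true⁻ (∧-conicalʳ (isClique G# s) _ clique∧size)
            v = proj₁ (onto s clique size≡d)
            v↦s = proj₂ (onto s clique size≡d)
            v∈level = ∈-filterᵇ⁺ (∈-allFin v)
              (≡ᵇ-true (trans (sym (size-separatingSet v)) (trans (cong (size G#) v↦s) size≡d)))

    agreeing-coefficients⇒onto : ∀ d → LevelOfCliques d → wCoeff G u d ≡ clCoeff G# d →
      ∀ s → isClique G# s ≡ true → size G# s ≡ d → ∃[ v ] separatingSet v ≡ s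
    agreeing-coefficients⇒onto d cliques agree s clique size≡d = proj₁ found , sym (proj₂ (proj₂ found))
      where
        found = ∈-map⁻ separatingSet (Unique⊆-length≡⇒⊇ (≡-dec Bool._≟_) (separatingSets-Unique d)
                  (level⊆cliquesOfSize cliques) (trans (length-level d) agree) (∈-cliquesOfSize s clique size≡d))

    -- Equivalently, every Θ-class has an edge incident with u.
    SingletonsRealised : Set
    SingletonsRealised = ∀ r → ∃[ z ] separates z r ≡ true × (∀ s → separates z s ≡ true → s ≡ r)

    new-class-crosses : SingletonsRealised → ∀ y v r₀ → separates y r₀ ≡ false → separates v r₀ ≡ true →
      ∀ j → j ≢ r₀ → separates y j ≡ true → separates v j ≡ true → Graph.adj G# r₀ j ≡ true
    new-class-crosses singletons y v r₀ y∌r₀ v∋r₀ j j≢r₀ y∋j v∋j =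
      Equivalence.from (crosses⇔separated r₀ j) λ where
        true  true  → v , v∋r₀ , v∋j
        true  false → z , z∋r₀ , ≢true⇒≡false (j≢r₀ ∘ only-r₀ j)
        false true  → y , y∌r₀ , y∋j
        false false → u , separates-root r₀ , separates-root j
      where
        z = proj₁ (singletons r₀)
        z∋r₀ = proj₁ (proj₂ (singletons r₀))
        only-r₀ = proj₂ (proj₂ (singletons r₀))

    clique-extend : SingletonsRealised → ∀ y v r₀ → isClique G# (separatingSet y) ≡ true →
      (∀ j → j ≢ r₀ → separates y j ≡ separates v j) →
      separates y r₀ ≡ false → separates v r₀ ≡ true → isClique G# (separatingSet v) ≡ true
    clique-extend singletons y v r₀ y-clique agree y∌r₀ v∋r₀ = clique-intro (separatingSet v) crossing
      where
        member : ∀ w {r} → lookup (separatingSet w) r ≡ true → separates w r ≡ true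
        member w {r} = trans (sym (lookup-separatingSet w r))
        in-y : ∀ {r} → r ≢ r₀ → separates v r ≡ true → lookup (separatingSet y) r ≡ true
        in-y {r} r≢r₀ v∋r = trans (lookup-separatingSet y r) (trans (agree r r≢r₀) v∋r)
        crosses-r₀ : ∀ j → j ≢ r₀ → separates v j ≡ true → Graph.adj G# r₀ j ≡ true
        crosses-r₀ j j≢r₀ v∋j =
          new-class-crosses singletons y v r₀ y∌r₀ v∋r₀ j j≢r₀ (member y (in-y j≢r₀ v∋j)) v∋j
        crossing : IsClique (separatingSet v)
        crossing i j vᵢ vⱼ i≢j = by-cases (i ≟ r₀) (j ≟ r₀)
          where
            by-cases : Dec (i ≡ r₀) → Dec (j ≡ r₀) → Graph.adj G# i j ≡ true
            by-cases (yes i≡r₀) _ = subst (λ i → Graph.adj G# i j ≡ true) (sym i≡r₀)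
              (crosses-r₀ j (λ j≡r₀ → i≢j (trans i≡r₀ (sym j≡r₀))) (member v vⱼ))
            by-cases (no _) (yes j≡r₀) = trans (proj₁ G#-simple i j)
              (subst (λ j → Graph.adj G# j i ≡ true) (sym j≡r₀)
                (crosses-r₀ i (λ i≡r₀ → i≢j (trans i≡r₀ (sym j≡r₀))) (member v vᵢ)))
            by-cases (no i≢r₀) (no j≢r₀) = clique-elim (separatingSet y) y-clique i j
              (in-y i≢r₀ (member v vᵢ)) (in-y j≢r₀ (member v vⱼ)) i≢j

    one-class-more : ∀ y v d → adj y v ≡ true → dist G u y ≡ d → dist G u v ≡ suc d →
      ∃[ r₀ ] (∀ j → j ≢ r₀ → separates y j ≡ separates v j) ×
              separates y r₀ ≡ false × separates v r₀ ≡ true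
    one-class-more y v d e dist-y dist-v = r₀ , agree , proj₂ grows , proj₁ grows
      where
        one : hamming (separates y) (separates v) ≡ 1
        one = trans (separates-isometric y v) (adj⇒dist≡1 y v e)
        differing = countF-pos⇒∃ (λ r → separates y r xor separates v r) (≤-reflexive (sym one))
        r₀ = proj₁ differing
        differs = proj₂ differing
        agree : ∀ j → j ≢ r₀ → separates y j ≡ separates v j
        agree j j≢r₀ =
          xor-false⇒≡ (≢true⇒≡false λ differsⱼ → j≢r₀ (countF≡1⇒unique _ one j r₀ differsⱼ differs))
        grows = indicator-growth (separates y r₀) (separates v r₀) d differs
          (subst₂ (λ P Q → P + indicator (separates v r₀) ≡ Q + indicator (separates y r₀))
                  (trans (size-separates y) dist-y) (trans (size-separates v) dist-v)
                  (countF-update (separates y) (separates v) r₀ agree))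

    root-clique : isClique G# (separatingSet u) ≡ true
    root-clique = clique-intro (separatingSet u) λ i j uᵢ _ _ →
      ⊥-elim (true≢false (trans (sym uᵢ) (trans (lookup-separatingSet u i) (separates-root i))))

    separatingSet-clique : SingletonsRealised → ∀ d → LevelOfCliques d
    separatingSet-clique singletons zero    v dist≡0 =
      subst (λ w → isClique G# (separatingSet w) ≡ true) (dist≡0⇒≡ u v dist≡0) root-clique
    separatingSet-clique singletons (suc d) v dist-v =
      let (y , e , dist-y) = predecessor u v d dist-v
          (r₀ , agree , y∌r₀ , v∋r₀) = one-class-more y v d e dist-y dist-v
      in clique-extend singletons y v r₀ (separatingSet-clique singletons d y dist-y) agree y∌r₀ v∋r₀

    singletons-realised : wCoeff G u 1 ≡ clCoeff G# 1 → SingletonsRealised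
    singletons-realised agree r =
      z , trans (member r) (lookup-⁅⁆-self r) , λ s z∋s → lookup-⁅⁆⁻ r (trans (sym (member s)) z∋s)
      where
        level-1-cliques : LevelOfCliques 1
        level-1-cliques v dist≡1 = singleton-clique (separatingSet v) (trans (size-separatingSet v) dist≡1)
        found = agreeing-coefficients⇒onto 1 level-1-cliques agree
                  ⁅ r ⁆ (singleton-clique ⁅ r ⁆ (size-⁅⁆ r)) (size-⁅⁆ r)
        z = proj₁ found
        member : ∀ s → separates z s ≡ lookup ⁅ r ⁆ s
        member s = trans (sym (lookup-separatingSet z s)) (cong (λ t → lookup t s) (proj₂ found))

    coefficients⇒simplex : (∀ d → wCoeff G u d ≡ clCoeff G# d) → IsSimplexGraphAt G u
    coefficients⇒simplex agree = G# , G#-simple , separatingSet , (λ _ _ → separatingSet-injective) ,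
                                 (λ v → cliques _ v refl) , onto , adj≡simplexAdj , separatingSet-root
      where
        cliques = separatingSet-clique (singletons-realised (agree 1))
        onto : ∀ s → isClique G# s ≡ true → ∃[ v ] separatingSet v ≡ s
        onto s clique = agreeing-coefficients⇒onto _ (cliques _) (agree _) s clique refl

    module FromSimplexGraph (S : IsSimplexGraphAt G u) where
      H : Graph
      H = proj₁ S

      φ : Fin n → Subset (Graph.n H)
      φ = proj₁ (proj₂ (proj₂ S))

      φ-injective : ∀ a b → φ a ≡ φ b → a ≡ b
      φ-injective = proj₁ (proj₂ (proj₂ (proj₂ S)))

      φ-clique : ∀ a → isClique H (φ a) ≡ true
      φ-clique = proj₁ (proj₂ (proj₂ (proj₂ (proj₂ S))))

      φ-onto : ∀ s → isClique H s ≡ true → ∃[ a ] φ a ≡ s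
      φ-onto = proj₁ (proj₂ (proj₂ (proj₂ (proj₂ (proj₂ S)))))

      φ-adj : ∀ a b → adj a b ≡ simplexAdj H (φ a) (φ b)
      φ-adj = proj₁ (proj₂ (proj₂ (proj₂ (proj₂ (proj₂ (proj₂ S))))))

      φ-root : φ u ≡ Subset.⊥
      φ-root = proj₂ (proj₂ (proj₂ (proj₂ (proj₂ (proj₂ (proj₂ S))))))

      open SimplexGraphIsometry G simple (proj₁ partialCube) H φ φ-injective φ-clique φ-onto φ-adj
        using (g; φ-isometric)
      module φ-embedding = IsometricEmbedding G simple (proj₁ partialCube) g φ-isometric
      open Cliques H using ()
        renaming (clique-intro to H-clique-intro; clique-elim to H-clique-elim; singleton-clique to H-singleton-clique)

      vertexOf : Class → Fin (Graph.n H)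
      vertexOf r = proj₁ (φ-embedding.edge-flips _ _ (rep-adj r))

      vertexOf-flips : ∀ r → φ-embedding.Flips (vertexOf r) (rep₁ r) (rep₂ r)
      vertexOf-flips r = proj₂ (φ-embedding.edge-flips _ _ (rep-adj r))

      vertexOf-injective : Injective _≡_ _≡_ vertexOf
      vertexOf-injective {r} {s} same = reps-flipping-same-equal g φ-isometric r s (vertexOf r) (vertexOf-flips r)
        (subst (λ h → φ-embedding.Flips h (rep₁ s) (rep₂ s)) (sym same) (vertexOf-flips s))

      separates≡φ : ∀ w r → separates w r ≡ g w (vertexOf r)
      separates≡φ w r = begin
        inW u r xor inW w r
          ≡⟨ cong₂ _xor_ (φ-embedding.W-coordinate _ _ (rep-adj r) _ (vertexOf-flips r) u)
                         (φ-embedding.W-coordinate _ _ (rep-adj r) _ (vertexOf-flips r) w) ⟩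
        not (g u (vertexOf r) xor g (rep₁ r) (vertexOf r)) xor not (g w (vertexOf r) xor g (rep₁ r) (vertexOf r))
          ≡⟨ xor-not-cancel (g u (vertexOf r)) (g w (vertexOf r)) (g (rep₁ r) (vertexOf r)) ⟩
        g u (vertexOf r) xor g w (vertexOf r)
          ≡⟨ cong (λ s → lookup s (vertexOf r) xor g w (vertexOf r)) φ-root ⟩
        lookup Subset.⊥ (vertexOf r) xor g w (vertexOf r)
          ≡⟨ cong (_xor g w (vertexOf r)) (lookup-replicate (vertexOf r) false) ⟩
        g w (vertexOf r)
          ∎
        where open ≡-Reasoning

      singletons : SingletonsRealised
      singletons r = z , trans (member r) (lookup-⁅⁆-self (vertexOf r)) ,
                     λ s z∋s → vertexOf-injective (lookup-⁅⁆⁻ (vertexOf r) (trans (sym (member s)) z∋s))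
        where
          found = φ-onto ⁅ vertexOf r ⁆ (H-singleton-clique ⁅ vertexOf r ⁆ (size-⁅⁆ (vertexOf r)))
          z = proj₁ found
          member : ∀ s → separates z s ≡ lookup ⁅ vertexOf r ⁆ (vertexOf s)
          member s = trans (separates≡φ z s) (cong (λ t → lookup t (vertexOf s)) (proj₂ found))

      image-clique : ∀ s → isClique G# s ≡ true → isClique H (image vertexOf s) ≡ true
      image-clique s clique = H-clique-intro (image vertexOf s) λ h₁ h₂ h₁∈ h₂∈ h₁≢h₂ →
        case lookup-image⁻ vertexOf s h₁ h₁∈ , lookup-image⁻ vertexOf s h₂ h₂∈ of λ where
          ((r₁ , r₁∈ , refl) , (r₂ , r₂∈ , refl)) →
            let crosses = clique-elim s clique r₁ r₂ r₁∈ r₂∈ (h₁≢h₂ ∘ cong vertexOf)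
                (w , w∋r₁ , w∋r₂) = Equivalence.to (crosses⇔separated r₁ r₂) crosses true true
            in H-clique-elim (φ w) (φ-clique w) (vertexOf r₁) (vertexOf r₂)
                 (trans (sym (separates≡φ w r₁)) w∋r₁) (trans (sym (separates≡φ w r₂)) w∋r₂) h₁≢h₂

      separatingSet-onto : ∀ s → isClique G# s ≡ true → ∃[ v ] separatingSet v ≡ s
      separatingSet-onto s clique = v , lookup-ext λ r → begin
        lookup (separatingSet v) r             ≡⟨ lookup-separatingSet v r ⟩
        separates v r                          ≡⟨ separates≡φ v r ⟩
        lookup (φ v) (vertexOf r)              ≡⟨ cong (λ t → lookup t (vertexOf r)) (proj₂ found) ⟩
        lookup (image vertexOf s) (vertexOf r) ≡⟨ lookup-image vertexOf vertexOf-injective s r ⟩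
        lookup s r                             ∎
        where
          open ≡-Reasoning
          found = φ-onto (image vertexOf s) (image-clique s clique)
          v = proj₁ found

      all-coefficients-agree : ∀ d → wCoeff G u d ≡ clCoeff G# d
      all-coefficients-agree d =
        coefficients-agree d (separatingSet-clique singletons d) (λ s clique _ → separatingSet-onto s clique)

    simplex⇒coefficients : IsSimplexGraphAt G u → ∀ d → wCoeff G u d ≡ clCoeff G# d
    simplex⇒coefficients = FromSimplexGraph.all-coefficients-agree

theorem4 : (G : Graph) → IsSimple G → IsPartialCube G → (u : Fin (Graph.n G)) →
    IsSimplexGraphAt G u ⇔ (∀ (d : ℕ) → wCoeff G u d ≡ clCoeff (crossingGraph G) d)
theorem4 G simple partialCube u = mk⇔ simplex⇒coefficients coefficients⇒simplex
  where open PartialCube.Rooted G simple partialCube u
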